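{- Let $\mathbf H$ be either $\mathbf Z$ or $\mathbf N$. The set $X:=\bigcup_{n\ge2}\{a^n:a\in\mathbf H\}$ is small.
   Context: $\mathbf N=\{0,1,2,\dots\}$, $\mathbf N^+=\mathbf N\setminus\{0\}$. For $X\subseteq\mathbf H$, $k\in\mathbf N^+$, $h\in\mathbf N$ write $k\cdot X+h:=\{kx+h:x\in X\}$. An upper quasi-density on $\mathbf H$ is a function $\mu^\ast:\mathcal P(\mathbf H)\to\mathbf R$ such that for all $X,Y\subseteq\mathbf H$, $k\in\mathbf N^+$, $h\in\mathbf N$: $\mu^\ast(X)\le 1$, $\mu^\ast(\mathbf H)=1$, $\mu^\ast(X\cup Y)\le\mu^\ast(X)+\mu^\ast(Y)$, $\mu^\ast(k\cdot X)=\frac1k\mu^\ast(X)$, and $\mu^\ast(X+h)=\mu^\ast(X)$. A set $X\subseteq\mathbf H$ is small if $\mu^\ast(X)=0$ for every upper quasi-density $\mu^\ast$ on $\mathbf H$. -}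

module Defs where

open import Level using (0ℓ)
open import Data.Nat as ℕ using (ℕ; zero; suc)
open import Data.Integer as ℤ using (ℤ)
open import Data.Product using (Σ; ∃; _×_; _,_)
open import Data.Sum using (_⊎_)
open import Relation.Nullary using (¬_)
open import Relation.Binary.PropositionalEquality using (_≡_; _≢_)
open import Relation.Unary using (Pred; _⊆_)

-- The real numbers, axiomatised as a complete ordered field.
-- (Every complete ordered field is isomorphic to ℝ, so quantifying over
-- all of them is the same as speaking about ℝ.)

record CompleteOrderedField : Set₁ where
  infixl 6 _+_
  infixl 7 _*_
  infix  4 _≤_
  field
    Carrier : Set
    0# 1#   : Carrier
    _+_ _*_ : Carrier → Carrier → Carrier
    -_      : Carrier → Carrier
    _≤_     : Carrier → Carrier → Set
    +-assoc     : ∀ x y z → (x + y) + z ≡ x + (y + z)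
    +-comm      : ∀ x y → x + y ≡ y + x
    +-identityˡ : ∀ x → 0# + x ≡ x
    -‿inverseˡ  : ∀ x → (- x) + x ≡ 0#
    *-assoc     : ∀ x y z → (x * y) * z ≡ x * (y * z)
    *-comm      : ∀ x y → x * y ≡ y * x
    *-identityˡ : ∀ x → 1# * x ≡ x
    distribˡ    : ∀ x y z → x * (y + z) ≡ (x * y) + (x * z)
    0≢1         : 0# ≢ 1#
    *-inverse   : ∀ x → x ≢ 0# → ∃ λ y → x * y ≡ 1#
    ≤-refl    : ∀ x → x ≤ x
    ≤-antisym : ∀ {x y} → x ≤ y → y ≤ x → x ≡ y
    ≤-trans   : ∀ {x y z} → x ≤ y → y ≤ z → x ≤ z
    ≤-total   : ∀ x y → x ≤ y ⊎ y ≤ x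
    +-mono-≤  : ∀ {x y} z → x ≤ y → x + z ≤ y + z
    *-nonneg  : ∀ {x y} → 0# ≤ x → 0# ≤ y → 0# ≤ x * y
    sup : (P : Carrier → Set) → (∃ λ x → P x) →
          (∃ λ b → ∀ x → P x → x ≤ b) →
          ∃ λ s → (∀ x → P x → x ≤ s) ×
                  (∀ b → (∀ x → P x → x ≤ b) → s ≤ b)

  fromℕ : ℕ → Carrier
  fromℕ zero    = 0#
  fromℕ (suc n) = 1# + fromℕ n

-- A "domain" H (here ℕ or ℤ) with the operations x ↦ k x and x ↦ x + h
-- for k, h ∈ ℕ.

record Domain : Set₁ where
  field
    H     : Set
    scale : ℕ → H → H
    shift : ℕ → H → H

  _·_ : ℕ → Pred H 0ℓ → Pred H 0ℓ
  (k · X) y = ∃ λ x → X x × y ≡ scale k x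

  _⊕_ : Pred H 0ℓ → ℕ → Pred H 0ℓ
  (X ⊕ h) y = ∃ λ x → X x × y ≡ shift h x

  _∪_ : Pred H 0ℓ → Pred H 0ℓ → Pred H 0ℓ
  (X ∪ Y) y = X y ⊎ Y y

  Whole : Pred H 0ℓ
  Whole _ = Data.Unit.⊤
    where import Data.Unit

  -- upper quasi-density on H with values in the reals R.
  -- Subsets of H are predicates; since subsets are extensional objects,
  -- μ is required to respect extensional equality of predicates.
  record IsUpperQuasiDensity (R : CompleteOrderedField)
         (μ : Pred H 0ℓ → CompleteOrderedField.Carrier R) : Set₁ where
    open CompleteOrderedField R
    field
      extensional : ∀ {X Y} → X ⊆ Y → Y ⊆ X → μ X ≡ μ Y
      bounded     : ∀ X → μ X ≤ 1#
      whole       : μ Whole ≡ 1#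
      subadditive : ∀ X Y → μ (X ∪ Y) ≤ μ X + μ Y
      -- μ(k⋅X) = μ(X)/k, written as k ⋅ μ(k⋅X) = μ(X)
      homogeneous : ∀ X (k : ℕ) → 1 ℕ.≤ k → fromℕ k * μ (k · X) ≡ μ X
      invariant   : ∀ X (h : ℕ) → μ (X ⊕ h) ≡ μ X

  Small : Pred H 0ℓ → Set₁
  Small X = (R : CompleteOrderedField)
            (μ : Pred H 0ℓ → CompleteOrderedField.Carrier R) →
            IsUpperQuasiDensity R μ → μ X ≡ CompleteOrderedField.0# R

ℕ-Domain : Domain
ℕ-Domain = record { H = ℕ ; scale = λ k x → k ℕ.* x ; shift = λ h x → x ℕ.+ h }

ℤ-Domain : Domain
ℤ-Domain = record { H = ℤ ; scale = λ k x → ℤ.+ k ℤ.* x ; shift = λ h x → x ℤ.+ ℤ.+ h }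

PerfectPowersℕ : Pred ℕ 0ℓ
PerfectPowersℕ y = ∃ λ n → 2 ℕ.≤ n × ∃ λ (a : ℕ) → y ≡ a ℕ.^ n

PerfectPowersℤ : Pred ℤ 0ℓ
PerfectPowersℤ y = ∃ λ n → 2 ℕ.≤ n × ∃ λ (a : ℤ) → y ≡ a ℤ.^ n

-- If a prime q divides a perfect power, then q² divides it. Split H into the q residue classes
-- mod q: by homogeneity and shift invariance each class carries 1/q of the density of its rescaled
-- preimage, and inside the one class where q ∣ y only one class mod q² is non-empty. So every prime
-- q ≤ K multiplies the bound by (q² − q + 1)/q², giving μ*(X) ≤ ∏_{q ≤ K} (1 − (q − 1)/q²); the
-- induction runs over sets whose values a y + b have the property, with a free of primes ≤ K.
-- The product tends to 0 because ∑ 1/q diverges, shown as in Erdős's proof: at most half of the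
-- numbers up to 4^(k+1) are k-smooth, so the primes in (k, 4^(k+1)] shrink the product by 4/5.

module Submission where

open import Level using (0ℓ)
open import Defs
open import Data.Nat as ℕ using (ℕ; zero; suc)
import Data.Nat.Properties as ℕ
open import Data.Nat.Divisibility as ℕ using ()
open import Data.Nat.DivMod using (_/_; _%_; m%n<n; m≡m%n+[m/n]*n)
open import Data.Nat.Primality using (Prime; prime?; euclidsLemma; prime⇒irreducible)
open import Data.Integer as ℤ using (ℤ)
import Data.Integer.Properties as ℤ
open import Data.Integer.DivMod using (_%ℕ_; _/ℕ_; n%ℕd<d; a≡a%ℕn+[a/ℕn]*n)
open import Data.Product using (∃; ∃₂; _×_; _,_)
open import Data.Sum using (inj₁; inj₂)
open import Data.Empty using (⊥; ⊥-elim)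
open import Function using (_∘_)
open import Relation.Nullary using (¬_; yes; no)
open import Relation.Unary using (Pred)
open import Relation.Binary.Bundles using (Preorder)
import Relation.Binary.Reasoning.Preorder as PreorderReasoning
open import Relation.Binary.Reasoning.Syntax using (module ≤-syntax)
open import Relation.Binary.PropositionalEquality

module OrderedFieldProperties (R : CompleteOrderedField) where

  open CompleteOrderedField R
  open ≡-Reasoning

  +-identityʳ : ∀ x → x + 0# ≡ x
  +-identityʳ x = trans (+-comm x 0#) (+-identityˡ x)

  -‿inverseʳ : ∀ x → x + - x ≡ 0#
  -‿inverseʳ x = trans (+-comm x (- x)) (-‿inverseˡ x)

  *-identityʳ : ∀ x → x * 1# ≡ x
  *-identityʳ x = trans (*-comm x 1#) (*-identityˡ x)

  distribʳ : ∀ x y z → (y + z) * x ≡ y * x + z * x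
  distribʳ x y z = begin
    (y + z) * x    ≡⟨ *-comm (y + z) x ⟩
    x * (y + z)    ≡⟨ distribˡ x y z ⟩
    x * y + x * z  ≡⟨ cong₂ _+_ (*-comm x y) (*-comm x z) ⟩
    y * x + z * x  ∎

  +-cancelʳ : ∀ {x y} z → x + z ≡ y + z → x ≡ y
  +-cancelʳ {x} {y} z x+z≡y+z = begin
    x                ≡⟨ sym (+-identityʳ x) ⟩
    x + 0#           ≡⟨ cong (x +_) (sym (-‿inverseʳ z)) ⟩
    x + (z + - z)    ≡⟨ sym (+-assoc x z (- z)) ⟩
    (x + z) + - z    ≡⟨ cong (_+ - z) x+z≡y+z ⟩
    (y + z) + - z    ≡⟨ +-assoc y z (- z) ⟩
    y + (z + - z)    ≡⟨ cong (y +_) (-‿inverseʳ z) ⟩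
    y + 0#           ≡⟨ +-identityʳ y ⟩
    y                ∎

  x+x≡x⇒x≡0 : ∀ {x} → x + x ≡ x → x ≡ 0#
  x+x≡x⇒x≡0 {x} x+x≡x = +-cancelʳ x (trans x+x≡x (sym (+-identityˡ x)))

  *-zeroˡ : ∀ x → 0# * x ≡ 0#
  *-zeroˡ x = x+x≡x⇒x≡0 (trans (sym (distribʳ x 0# 0#)) (cong (_* x) (+-identityˡ 0#)))

  *-zeroʳ : ∀ x → x * 0# ≡ 0#
  *-zeroʳ x = trans (*-comm x 0#) (*-zeroˡ x)

  inverseˡ-unique : ∀ {x y} → x + y ≡ 0# → x ≡ - y
  inverseˡ-unique {x} {y} x+y≡0 = +-cancelʳ y (trans x+y≡0 (sym (-‿inverseˡ y)))

  -‿distribˡ-* : ∀ x y → - x * y ≡ - (x * y)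
  -‿distribˡ-* x y = inverseˡ-unique (begin
    - x * y + x * y  ≡⟨ sym (distribʳ y (- x) x) ⟩
    (- x + x) * y    ≡⟨ cong (_* y) (-‿inverseˡ x) ⟩
    0# * y           ≡⟨ *-zeroˡ y ⟩
    0#               ∎)

  -‿involutive : ∀ x → - (- x) ≡ x
  -‿involutive x = sym (inverseˡ-unique (-‿inverseʳ x))

  *-cancelˡ : ∀ {x y} c → c ≢ 0# → c * x ≡ c * y → x ≡ y
  *-cancelˡ {x} {y} c c≢0 cx≡cy with *-inverse c c≢0
  ... | c⁻¹ , cc⁻¹≡1 = begin
    x                ≡⟨ sym (*-identityˡ x) ⟩
    1# * x           ≡⟨ cong (_* x) (trans (sym cc⁻¹≡1) (*-comm c c⁻¹)) ⟩
    (c⁻¹ * c) * x    ≡⟨ *-assoc c⁻¹ c x ⟩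
    c⁻¹ * (c * x)    ≡⟨ cong (c⁻¹ *_) cx≡cy ⟩
    c⁻¹ * (c * y)    ≡⟨ sym (*-assoc c⁻¹ c y) ⟩
    (c⁻¹ * c) * y    ≡⟨ cong (_* y) (trans (*-comm c⁻¹ c) cc⁻¹≡1) ⟩
    1# * y           ≡⟨ *-identityˡ y ⟩
    y                ∎

  ≤-preorder : Preorder 0ℓ 0ℓ 0ℓ
  ≤-preorder = record
    { Carrier = Carrier ; _≈_ = _≡_ ; _≲_ = _≤_
    ; isPreorder = record { isEquivalence = isEquivalence ; reflexive = λ { {x} refl → ≤-refl x } ; trans = ≤-trans } }

  module ≤-Reasoning where
    open PreorderReasoning ≤-preorder public
    open ≤-syntax _IsRelatedTo_ _IsRelatedTo_ ≲-go public

  +-monoʳ-≤ : ∀ {x y} z → x ≤ y → z + x ≤ z + y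
  +-monoʳ-≤ {x} {y} z x≤y = subst₂ _≤_ (+-comm x z) (+-comm y z) (+-mono-≤ z x≤y)

  +-mono₂-≤ : ∀ {x y u v} → x ≤ y → u ≤ v → x + u ≤ y + v
  +-mono₂-≤ {y = y} {u = u} x≤y u≤v = ≤-trans (+-mono-≤ u x≤y) (+-monoʳ-≤ y u≤v)

  +-cancelʳ-≤ : ∀ {x y} z → x + z ≤ y + z → x ≤ y
  +-cancelʳ-≤ {x} {y} z x+z≤y+z = subst₂ _≤_ (cancel x) (cancel y) (+-mono-≤ (- z) x+z≤y+z)
    where
    cancel : ∀ w → (w + z) + - z ≡ w
    cancel w = trans (+-assoc w z (- z)) (trans (cong (w +_) (-‿inverseʳ z)) (+-identityʳ w))

  x≤0⇒0≤-x : ∀ {x} → x ≤ 0# → 0# ≤ - x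
  x≤0⇒0≤-x {x} x≤0 = subst₂ _≤_ (-‿inverseʳ x) (+-identityˡ (- x)) (+-mono-≤ (- x) x≤0)

  0≤1 : 0# ≤ 1#
  0≤1 with ≤-total 0# 1#
  ... | inj₁ 0≤1 = 0≤1
  ... | inj₂ 1≤0 = subst (0# ≤_) -1*-1≡1 (*-nonneg 0≤-1 0≤-1)
    where
    0≤-1 : 0# ≤ - 1#
    0≤-1 = x≤0⇒0≤-x 1≤0
    -1*-1≡1 : - 1# * - 1# ≡ 1#
    -1*-1≡1 = trans (-‿distribˡ-* 1# (- 1#)) (trans (cong -_ (*-identityˡ (- 1#))) (-‿involutive 1#))

  *-monoʳ-≤-nonNeg : ∀ {x y} c → 0# ≤ c → x ≤ y → c * x ≤ c * y
  *-monoʳ-≤-nonNeg {x} {y} c 0≤c x≤y =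
    subst₂ _≤_ (+-identityˡ (c * x)) c[y-x]+cx≡cy (+-mono-≤ (c * x) (*-nonneg 0≤c 0≤y-x))
    where
    0≤y-x : 0# ≤ y + - x
    0≤y-x = subst₂ _≤_ (-‿inverseʳ x) refl (+-mono-≤ (- x) x≤y)
    c[y-x]+cx≡cy : c * (y + - x) + c * x ≡ c * y
    c[y-x]+cx≡cy = begin
      c * (y + - x) + c * x  ≡⟨ sym (distribˡ c (y + - x) x) ⟩
      c * ((y + - x) + x)    ≡⟨ cong (c *_) (+-assoc y (- x) x) ⟩
      c * (y + (- x + x))    ≡⟨ cong (λ w → c * (y + w)) (-‿inverseˡ x) ⟩
      c * (y + 0#)           ≡⟨ cong (c *_) (+-identityʳ y) ⟩
      c * y                  ∎

  fromℕ-1 : fromℕ 1 ≡ 1#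
  fromℕ-1 = +-identityʳ 1#

  fromℕ-+ : ∀ m n → fromℕ (m ℕ.+ n) ≡ fromℕ m + fromℕ n
  fromℕ-+ zero    n = sym (+-identityˡ (fromℕ n))
  fromℕ-+ (suc m) n = trans (cong (1# +_) (fromℕ-+ m n)) (sym (+-assoc 1# (fromℕ m) (fromℕ n)))

  fromℕ-* : ∀ m n → fromℕ (m ℕ.* n) ≡ fromℕ m * fromℕ n
  fromℕ-* zero    n = sym (*-zeroˡ (fromℕ n))
  fromℕ-* (suc m) n = begin
    fromℕ (n ℕ.+ m ℕ.* n)               ≡⟨ fromℕ-+ n (m ℕ.* n) ⟩
    fromℕ n + fromℕ (m ℕ.* n)           ≡⟨ cong₂ _+_ (sym (*-identityˡ (fromℕ n))) (fromℕ-* m n) ⟩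
    1# * fromℕ n + fromℕ m * fromℕ n    ≡⟨ sym (distribʳ (fromℕ n) 1# (fromℕ m)) ⟩
    (1# + fromℕ m) * fromℕ n            ∎

  fromℕ-nonNeg : ∀ n → 0# ≤ fromℕ n
  fromℕ-nonNeg zero    = ≤-refl 0#
  fromℕ-nonNeg (suc n) = subst (_≤ fromℕ (suc n)) (+-identityˡ 0#) (+-mono₂-≤ 0≤1 (fromℕ-nonNeg n))

  fromℕ-mono-≤ : ∀ {m n} → m ℕ.≤ n → fromℕ m ≤ fromℕ n
  fromℕ-mono-≤ {m} {n} m≤n = subst₂ _≤_ (+-identityʳ (fromℕ m)) fromℕ-m+[n∸m]
    (+-monoʳ-≤ (fromℕ m) (fromℕ-nonNeg (n ℕ.∸ m)))
    where
    fromℕ-m+[n∸m] : fromℕ m + fromℕ (n ℕ.∸ m) ≡ fromℕ n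
    fromℕ-m+[n∸m] = trans (sym (fromℕ-+ m (n ℕ.∸ m))) (cong fromℕ (ℕ.m+[n∸m]≡n m≤n))

  fromℕ-suc≢0 : ∀ n → fromℕ (suc n) ≢ 0#
  fromℕ-suc≢0 n 1+n≡0 = 0≢1 (≤-antisym 0≤1 1≤0)
    where
    1≤0 : 1# ≤ 0#
    1≤0 = subst₂ _≤_ (+-identityʳ 1#) 1+n≡0 (+-monoʳ-≤ 1# (fromℕ-nonNeg n))

  fromℕ-*-cancelˡ-≤ : ∀ {x y} n → 1 ℕ.≤ n → fromℕ n * x ≤ fromℕ n * y → x ≤ y
  fromℕ-*-cancelˡ-≤ {x} {y} (suc n) _ nx≤ny with ≤-total x y
  ... | inj₁ x≤y = x≤y
  ... | inj₂ y≤x = subst (x ≤_) x≡y (≤-refl x)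
    where
    x≡y : x ≡ y
    x≡y = *-cancelˡ (fromℕ (suc n)) (fromℕ-suc≢0 n)
            (≤-antisym nx≤ny (*-monoʳ-≤-nonNeg (fromℕ (suc n)) (fromℕ-nonNeg (suc n)) y≤x))

  x*[y*z]≡y*[x*z] : ∀ x y z → x * (y * z) ≡ y * (x * z)
  x*[y*z]≡y*[x*z] x y z = trans (sym (*-assoc x y z)) (trans (cong (_* z) (*-comm x y)) (*-assoc y x z))

  -- The supremum s of {N x} satisfies s ≤ s − x, which forces x ≤ 0.
  archimedean : ∀ x → 0# ≤ x → (∀ N → fromℕ N * x ≤ 1#) → x ≡ 0#
  archimedean x 0≤x Nx≤1
    with sup Multiple (0# * x , 0 , refl) (1# , λ { _ (N , refl) → Nx≤1 N })
    where
    Multiple : Carrier → Set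
    Multiple z = ∃ λ N → z ≡ fromℕ N * x
  ... | s , s-upper , s-least = ≤-antisym x≤0 0≤x
    where
    [1+N]x-x : ∀ N → (x + fromℕ N * x) + - x ≡ fromℕ N * x
    [1+N]x-x N = begin
      (x + fromℕ N * x) + - x  ≡⟨ cong (_+ - x) (+-comm x _) ⟩
      (fromℕ N * x + x) + - x  ≡⟨ +-assoc _ x (- x) ⟩
      fromℕ N * x + (x + - x)  ≡⟨ cong (fromℕ N * x +_) (-‿inverseʳ x) ⟩
      fromℕ N * x + 0#         ≡⟨ +-identityʳ _ ⟩
      fromℕ N * x              ∎
    s-x-upper : ∀ z → (∃ λ N → z ≡ fromℕ N * x) → z ≤ s + - x
    s-x-upper _ (N , refl) = subst₂ _≤_ ([1+N]x-x N) refl (+-mono-≤ (- x) [1+N]x≤s)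
      where
      [1+N]x≤s : x + fromℕ N * x ≤ s
      [1+N]x≤s = subst (_≤ s) (trans (distribʳ x 1# (fromℕ N)) (cong (_+ fromℕ N * x) (*-identityˡ x)))
                   (s-upper _ (suc N , refl))
    s-x+x≡0+s : (s + - x) + x ≡ 0# + s
    s-x+x≡0+s = begin
      (s + - x) + x  ≡⟨ +-assoc s (- x) x ⟩
      s + (- x + x)  ≡⟨ cong (s +_) (-‿inverseˡ x) ⟩
      s + 0#         ≡⟨ +-comm s 0# ⟩
      0# + s         ∎
    x≤0 : x ≤ 0#
    x≤0 = +-cancelʳ-≤ s (subst₂ _≤_ (+-comm s x) s-x+x≡0+s (+-mono-≤ x (s-least (s + - x) s-x-upper)))

  ∑ : ℕ → (ℕ → Carrier) → Carrier
  ∑ zero    f = 0#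
  ∑ (suc n) f = f n + ∑ n f

  *-distribˡ-∑ : ∀ c n f → c * ∑ n f ≡ ∑ n (λ r → c * f r)
  *-distribˡ-∑ c zero    f = *-zeroʳ c
  *-distribˡ-∑ c (suc n) f = trans (distribˡ c (f n) (∑ n f)) (cong (c * f n +_) (*-distribˡ-∑ c n f))

  ∑-≤-const : ∀ n f B → (∀ r → r ℕ.< n → f r ≤ B) → ∑ n f ≤ fromℕ n * B
  ∑-≤-const zero    f B f≤B = subst (0# ≤_) (sym (*-zeroˡ B)) (≤-refl 0#)
  ∑-≤-const (suc n) f B f≤B = subst (∑ (suc n) f ≤_) B+nB≡[1+n]B
    (+-mono₂-≤ (f≤B n (ℕ.n<1+n n)) (∑-≤-const n f B (λ r r<n → f≤B r (ℕ.m<n⇒m<1+n r<n))))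
    where
    B+nB≡[1+n]B : B + fromℕ n * B ≡ (1# + fromℕ n) * B
    B+nB≡[1+n]B = trans (cong (_+ fromℕ n * B) (sym (*-identityˡ B))) (sym (distribʳ B 1# (fromℕ n)))

  ∑-≤-except : ∀ n f B B′ t₀ → t₀ ℕ.< n → (∀ t → t ℕ.< n → t ≢ t₀ → f t ≤ B) → f t₀ ≤ B′ →
               ∑ n f ≤ fromℕ (n ℕ.∸ 1) * B + B′
  ∑-≤-except (suc n) f B B′ t₀ t₀<1+n f≤B ft₀≤B′ with t₀ ℕ.≟ n
  ... | yes refl = subst (∑ (suc n) f ≤_) (+-comm B′ _)
    (+-mono₂-≤ ft₀≤B′ (∑-≤-const n f B (λ r r<n → f≤B r (ℕ.m<n⇒m<1+n r<n) (λ { refl → ℕ.<-irrefl refl r<n }))))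
  ... | no t₀≢n = subst (∑ (suc n) f ≤_) B+[[n-1]B+B′]≡nB+B′
    (+-mono₂-≤ (f≤B n (ℕ.n<1+n n) (λ n≡t₀ → t₀≢n (sym n≡t₀)))
               (∑-≤-except n f B B′ t₀ t₀<n (λ t t<n → f≤B t (ℕ.m<n⇒m<1+n t<n)) ft₀≤B′))
    where
    t₀<n : t₀ ℕ.< n
    t₀<n = ℕ.≤∧≢⇒< (ℕ.≤-pred t₀<1+n) t₀≢n
    n≡1+[n-1] : n ≡ suc (n ℕ.∸ 1)
    n≡1+[n-1] = sym (ℕ.suc-pred n {{ℕ.>-nonZero (ℕ.≤-<-trans ℕ.z≤n t₀<n)}})
    B+[[n-1]B+B′]≡nB+B′ : B + (fromℕ (n ℕ.∸ 1) * B + B′) ≡ fromℕ n * B + B′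
    B+[[n-1]B+B′]≡nB+B′ = begin
      B + (fromℕ (n ℕ.∸ 1) * B + B′)         ≡⟨ sym (+-assoc B _ B′) ⟩
      (B + fromℕ (n ℕ.∸ 1) * B) + B′         ≡⟨ cong (_+ B′) (cong (_+ fromℕ (n ℕ.∸ 1) * B) (sym (*-identityˡ B))) ⟩
      (1# * B + fromℕ (n ℕ.∸ 1) * B) + B′    ≡⟨ cong (_+ B′) (sym (distribʳ B 1# (fromℕ (n ℕ.∸ 1)))) ⟩
      fromℕ (suc (n ℕ.∸ 1)) * B + B′         ≡⟨ cong (λ m → fromℕ m * B + B′) (sym n≡1+[n-1]) ⟩
      fromℕ n * B + B′                       ∎

module AffineMaps (dom : Domain) where

  open Domain dom

  affine : ℕ → ℕ → H → H
  affine m r z = shift r (scale m z)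

  DivisionWithRemainder : Set
  DivisionWithRemainder = ∀ m → 1 ℕ.≤ m → ∀ y → ∃₂ λ z r → r ℕ.< m × y ≡ affine m r z

module QuasiDensityProperties
  (dom : Domain) (division : AffineMaps.DivisionWithRemainder dom)
  (R : CompleteOrderedField) {μ : Pred (Domain.H dom) 0ℓ → CompleteOrderedField.Carrier R}
  (isμ : Domain.IsUpperQuasiDensity dom R μ) where

  open Domain dom
  open AffineMaps dom
  open CompleteOrderedField R
  open OrderedFieldProperties R
  open IsUpperQuasiDensity isμ
  open ≤-Reasoning

  μ-nonNeg : ∀ X → 0# ≤ μ X
  μ-nonNeg X = +-cancelʳ-≤ (μ X) (subst₂ _≤_ μ[X∪X]≡0+μX (+-comm (μ X) (μ X)) (subadditive X X))
    where
    μ[X∪X]≡0+μX : μ (X ∪ X) ≡ 0# + μ X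
    μ[X∪X]≡0+μX = trans (extensional (λ { (inj₁ x) → x ; (inj₂ x) → x }) inj₁) (sym (+-identityˡ (μ X)))

  ∅ : Pred H 0ℓ
  ∅ _ = ⊥

  μ-∅ : μ ∅ ≡ 0#
  μ-∅ = x+x≡x⇒x≡0 (begin-equality
    μ ∅ + μ ∅                ≡⟨ cong₂ _+_ (sym (*-identityˡ (μ ∅))) (sym (*-identityˡ (μ ∅))) ⟩
    1# * μ ∅ + 1# * μ ∅      ≡⟨ sym (distribʳ (μ ∅) 1# 1#) ⟩
    (1# + 1#) * μ ∅          ≡⟨ cong (λ w → (1# + w) * μ ∅) (sym fromℕ-1) ⟩
    fromℕ 2 * μ ∅            ≡⟨ cong (fromℕ 2 *_) (extensional {∅} {2 · ∅} (λ ()) (λ ())) ⟩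
    fromℕ 2 * μ (2 · ∅)      ≡⟨ homogeneous ∅ 2 (ℕ.s≤s ℕ.z≤n) ⟩
    μ ∅                      ∎)

  μ-empty : ∀ Y → (∀ y → ¬ Y y) → μ Y ≡ 0#
  μ-empty Y Y-empty = trans (extensional (λ {y} → Y-empty y) λ ()) μ-∅

  residuePiece : ℕ → Pred H 0ℓ → ℕ → Pred H 0ℓ
  residuePiece m Y r = (m · (Y ∘ affine m r)) ⊕ r

  residuePieces : ℕ → Pred H 0ℓ → ℕ → Pred H 0ℓ
  residuePieces m Y zero    = ∅
  residuePieces m Y (suc n) = residuePiece m Y n ∪ residuePieces m Y n

  residuePiece⊆residuePieces : ∀ m Y n r → r ℕ.< n → ∀ {y} → residuePiece m Y r y → residuePieces m Y n y
  residuePiece⊆residuePieces m Y (suc n) r r<1+n y∈piece with r ℕ.≟ n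
  ... | yes refl = inj₁ y∈piece
  ... | no r≢n   = inj₂ (residuePiece⊆residuePieces m Y n r (ℕ.≤∧≢⇒< (ℕ.≤-pred r<1+n) r≢n) y∈piece)

  residuePieces⊆ : ∀ m Y n {y} → residuePieces m Y n y → Y y
  residuePieces⊆ m Y (suc n) (inj₁ (_ , (_ , Y[mz+r] , refl) , refl)) = Y[mz+r]
  residuePieces⊆ m Y (suc n) (inj₂ y∈pieces)                          = residuePieces⊆ m Y n y∈pieces

  μ-residuePieces : ∀ m Y → 1 ℕ.≤ m → ∀ n → fromℕ m * μ (residuePieces m Y n) ≤ ∑ n (λ r → μ (Y ∘ affine m r))
  μ-residuePieces m Y 1≤m zero = begin
    fromℕ m * μ ∅  ≡⟨ cong (fromℕ m *_) μ-∅ ⟩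
    fromℕ m * 0#   ≡⟨ *-zeroʳ (fromℕ m) ⟩
    0#             ∎
  μ-residuePieces m Y 1≤m (suc n) = begin
    fromℕ m * μ (piece ∪ pieces)                 ≤⟨ *-monoʳ-≤-nonNeg (fromℕ m) (fromℕ-nonNeg m) (subadditive piece pieces) ⟩
    fromℕ m * (μ piece + μ pieces)               ≡⟨ distribˡ (fromℕ m) (μ piece) (μ pieces) ⟩
    fromℕ m * μ piece + fromℕ m * μ pieces       ≤⟨ +-mono₂-≤ (≤-refl (fromℕ m * μ piece)) (μ-residuePieces m Y 1≤m n) ⟩
    fromℕ m * μ piece + ∑ n (λ r → μ (Y ∘ affine m r))
                                                 ≡⟨ cong (_+ ∑ n (λ r → μ (Y ∘ affine m r))) m*μ-piece ⟩
    ∑ (suc n) (λ r → μ (Y ∘ affine m r))         ∎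
    where
    piece pieces : Pred H 0ℓ
    piece  = residuePiece m Y n
    pieces = residuePieces m Y n
    m*μ-piece : fromℕ m * μ piece ≡ μ (Y ∘ affine m n)
    m*μ-piece = trans (cong (fromℕ m *_) (invariant (m · (Y ∘ affine m n)) n)) (homogeneous (Y ∘ affine m n) m 1≤m)

  μ-residue-split : ∀ m Y → 1 ℕ.≤ m → fromℕ m * μ Y ≤ ∑ m (λ r → μ (Y ∘ affine m r))
  μ-residue-split m Y 1≤m = begin
    fromℕ m * μ Y                       ≡⟨ cong (fromℕ m *_) (extensional Y⊆pieces (residuePieces⊆ m Y m)) ⟩
    fromℕ m * μ (residuePieces m Y m)   ≤⟨ μ-residuePieces m Y 1≤m m ⟩
    ∑ m (λ r → μ (Y ∘ affine m r))      ∎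
    where
    Y⊆pieces : ∀ {y} → Y y → residuePieces m Y m y
    Y⊆pieces {y} Yy with division m 1≤m y
    ... | z , r , r<m , refl = residuePiece⊆residuePieces m Y m r r<m (scale m z , (z , Yy , refl) , refl)

module LinearCongruence where

  open import Data.Nat.Divisibility using (divides)
  open import Data.Nat.DivMod using (m<n⇒m%n≡m)
  open import Data.Nat.Primality using (prime⇒nonZero)
  open import Data.Nat.Coprimality using (Coprime; coprime-Bézout)
  open import Data.Nat.GCD using (module Bézout)
  open import Data.Integer using (+_; -_; _+_; _*_; _-_)
  open import Data.Integer.Divisibility.Signed using (_∣_; divides; ∣⇒∣ᵤ; ∣m∣n⇒∣m-n; ∣n⇒∣m*n; ∣-refl)
  open import Data.Integer.Tactic.RingSolver using (solve-∀)

  prime∤⇒coprime : ∀ {q a} → Prime q → ¬ (q ℕ.∣ a) → Coprime q a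
  prime∤⇒coprime {q} {a} q-prime q∤a (i∣q , i∣a) with prime⇒irreducible q-prime i∣q
  ... | inj₁ i≡1  = i≡1
  ... | inj₂ refl = ⊥-elim (q∤a i∣a)

  ∣-<⇒≡0 : ∀ {q d} → q ℕ.∣ d → d ℕ.< q → d ≡ 0
  ∣-<⇒≡0 {q} {d} q∣d d<q = trans (sym (m<n⇒m%n≡m d<q)) (ℕ.n∣m⇒m%n≡0 d q q∣d)
    where instance _ = ℕ.>-nonZero (ℕ.≤-<-trans ℕ.z≤n d<q)

  private
    1+m*n≡k*l⇒ℤ : ∀ m n k l → 1 ℕ.+ m ℕ.* n ≡ k ℕ.* l → + 1 + + m * + n ≡ + k * + l
    1+m*n≡k*l⇒ℤ m n k l eq = begin
      + 1 + + m * + n     ≡⟨ cong (λ w → + 1 + w) (sym (ℤ.pos-* m n)) ⟩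
      + (1 ℕ.+ m ℕ.* n)   ≡⟨ cong +_ eq ⟩
      + (k ℕ.* l)         ≡⟨ ℤ.pos-* k l ⟩
      + k * + l           ∎
      where open ≡-Reasoning

  -- Bézout gives a y ≡ ∓1 (mod q), so u = ± b y solves a u + b ≡ 0.
  congruence-solvableᶻ : ∀ {q a} → Prime q → ¬ (q ℕ.∣ a) → ∀ b → ∃ λ u → + q ∣ + a * u + b
  congruence-solvableᶻ {q} {a} q-prime q∤a b with coprime-Bézout (prime∤⇒coprime q-prime q∤a)
  ... | Bézout.+- x y 1+ya≡xq = b * + y , divides (b * + x) (begin
    + a * (b * + y) + b      ≡⟨ factor (+ a) b (+ y) ⟩
    b * (+ 1 + + y * + a)    ≡⟨ cong (b *_) (1+m*n≡k*l⇒ℤ y a x q 1+ya≡xq) ⟩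
    b * (+ x * + q)          ≡⟨ sym (ℤ.*-assoc b (+ x) (+ q)) ⟩
    b * + x * + q            ∎)
    where
    open ≡-Reasoning
    factor : ∀ a b y → a * (b * y) + b ≡ b * (+ 1 + y * a)
    factor = solve-∀
  ... | Bézout.-+ x y 1+xq≡ya = - b * + y , divides (- b * + x) (begin
    + a * (- b * + y) + b    ≡⟨ factor (+ a) b (+ y) ⟩
    - b * (+ y * + a) + b    ≡⟨ cong (λ w → - b * w + b) (sym (1+m*n≡k*l⇒ℤ x q y a 1+xq≡ya)) ⟩
    - b * (+ 1 + + x * + q) + b  ≡⟨ expand b (+ x) (+ q) ⟩
    - b * + x * + q          ∎)
    where
    open ≡-Reasoning
    factor : ∀ a b y → a * (- b * y) + b ≡ - b * (y * a) + b
    factor = solve-∀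
    expand : ∀ b x q → - b * (+ 1 + x * q) + b ≡ - b * x * q
    expand = solve-∀

  congruence-solvable : ∀ {q a} → Prime q → ¬ (q ℕ.∣ a) → ∀ b → ∃ λ t → t ℕ.< q × + q ∣ + a * + t + b
  congruence-solvable {q} {a} q-prime q∤a b with congruence-solvableᶻ q-prime q∤a b
  ... | u , q∣au+b = u %ℕ q , n%ℕd<d u q ,
        subst (+ q ∣_) (sym a[u%q]+b≡) (∣m∣n⇒∣m-n q∣au+b (∣n⇒∣m*n (+ a * (u /ℕ q)) ∣-refl))
    where
    instance _ = prime⇒nonZero q-prime
    open ≡-Reasoning
    a[u%q]+b≡ : + a * + (u %ℕ q) + b ≡ (+ a * u + b) - + a * (u /ℕ q) * + q
    a[u%q]+b≡ = begin
      + a * + (u %ℕ q) + b                              ≡⟨ reduce (+ a) (+ (u %ℕ q)) (u /ℕ q) (+ q) b ⟩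
      (+ a * (+ (u %ℕ q) + u /ℕ q * + q) + b) - + a * (u /ℕ q) * + q
                                                        ≡⟨ cong (λ w → (+ a * w + b) - + a * (u /ℕ q) * + q)
                                                                (sym (a≡a%ℕn+[a/ℕn]*n u q)) ⟩
      (+ a * u + b) - + a * (u /ℕ q) * + q             ∎
      where
      reduce : ∀ a r k q b → a * r + b ≡ (a * (r + k * q) + b) - a * k * q
      reduce = solve-∀

  private
    congruence-unique-≤ : ∀ {q a} → Prime q → ¬ (q ℕ.∣ a) → ∀ b {t t′} → t′ ℕ.≤ t → t ℕ.< q →
                          + q ∣ + a * + t + b → + q ∣ + a * + t′ + b → t ≡ t′
    congruence-unique-≤ {q} {a} q-prime q∤a b {t} {t′} t′≤t t<q q∣at+b q∣at′+b =
      ℕ.≤-antisym (ℕ.m∸n≡0⇒m≤n d≡0) t′≤t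
      where
      d : ℕ
      d = t ℕ.∸ t′
      difference : (+ a * + t + b) - (+ a * + t′ + b) ≡ + (a ℕ.* d)
      difference = begin
        (+ a * + t + b) - (+ a * + t′ + b)               ≡⟨ cong (λ w → (+ a * w + b) - (+ a * + t′ + b))
                                                              (trans (cong +_ (sym (ℕ.m+[n∸m]≡n t′≤t))) (ℤ.pos-+ t′ d)) ⟩
        (+ a * (+ t′ + + d) + b) - (+ a * + t′ + b)      ≡⟨ cancel (+ a) (+ t′) (+ d) b ⟩
        + a * + d                                        ≡⟨ sym (ℤ.pos-* a d) ⟩
        + (a ℕ.* d)                                      ∎
        where
        open ≡-Reasoning
        cancel : ∀ a t d b → (a * (t + d) + b) - (a * t + b) ≡ a * d
        cancel = solve-∀
      d≡0 : d ≡ 0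
      d≡0 with euclidsLemma a d q-prime (∣⇒∣ᵤ (subst (+ q ∣_) difference (∣m∣n⇒∣m-n q∣at+b q∣at′+b)))
      ... | inj₁ q∣a = ⊥-elim (q∤a q∣a)
      ... | inj₂ q∣d = ∣-<⇒≡0 q∣d (ℕ.≤-<-trans (ℕ.m∸n≤m t t′) t<q)

  congruence-unique : ∀ {q a} → Prime q → ¬ (q ℕ.∣ a) → ∀ b {t t′} → t ℕ.< q → t′ ℕ.< q →
                      + q ∣ + a * + t + b → + q ∣ + a * + t′ + b → t ≡ t′
  congruence-unique q-prime q∤a b {t} {t′} t<q t′<q q∣at+b q∣at′+b with ℕ.≤-total t′ t
  ... | inj₁ t′≤t = congruence-unique-≤ q-prime q∤a b t′≤t t<q q∣at+b q∣at′+b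
  ... | inj₂ t≤t′ = sym (congruence-unique-≤ q-prime q∤a b t≤t′ t′<q q∣at′+b q∣at+b)

module PrimeProductDivergence where

  open import Data.Nat using (_+_; _*_; _∸_; _^_; _≤_; _<_; z≤n; s≤s; _≤?_)
  open import Data.Nat.Properties
  open import Data.Nat.Divisibility using (_∣_; _∣?_; divides; ∣⇒≤; ∣m+n∣m⇒∣n; n∣m*n; ∣-trans)
  open import Data.Nat.Primality using (prime⇒nonTrivial)
  open import Data.Nat.Primality.Factorisation using (factorise)
  open import Data.Nat.ListAction using (product)
  open import Data.Nat.Tactic.RingSolver using (solve-∀)
  open import Data.List using (List; []; _∷_; _++_; map; length; cartesianProductWith; upTo)
  open import Data.List.Properties using (length-++; length-map; length-upTo)
  open import Data.List.Membership.Propositional using (_∈_)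
  open import Data.List.Membership.Propositional.Properties using (∈-++⁺ˡ; ∈-++⁺ʳ; ∈-map⁺; ∈-cartesianProductWith⁺; ∈-upTo⁺)
  open import Data.List.Membership.DecPropositional ℕ._≟_ using (_∈?_)
  open import Data.List.Relation.Unary.Any using (here)
  open import Data.List.Relation.Unary.All using (_∷_)
  open import Relation.Nullary using (Dec; _×-dec_)

  𝟙 : ∀ {p} {P : Set p} → Dec P → ℕ
  𝟙 (yes _) = 1
  𝟙 (no _)  = 0

  ∑< ∏< : ℕ → (ℕ → ℕ) → ℕ
  ∑< zero    f = 0
  ∑< (suc n) f = f n + ∑< n f
  ∏< zero    f = 1
  ∏< (suc n) f = f n * ∏< n f

  ∑<-mono-≤ : ∀ n {f g} → (∀ i → i < n → f i ≤ g i) → ∑< n f ≤ ∑< n g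
  ∑<-mono-≤ zero    f≤g = z≤n
  ∑<-mono-≤ (suc n) f≤g = +-mono-≤ (f≤g n ≤-refl) (∑<-mono-≤ n (λ i i<n → f≤g i (m<n⇒m<1+n i<n)))

  ∑<-cong : ∀ n {f g} → (∀ i → i < n → f i ≡ g i) → ∑< n f ≡ ∑< n g
  ∑<-cong zero    f≡g = refl
  ∑<-cong (suc n) f≡g = cong₂ _+_ (f≡g n ≤-refl) (∑<-cong n (λ i i<n → f≡g i (m<n⇒m<1+n i<n)))

  ∏<-cong : ∀ n {f g} → (∀ i → i < n → f i ≡ g i) → ∏< n f ≡ ∏< n g
  ∏<-cong zero    f≡g = refl
  ∏<-cong (suc n) f≡g = cong₂ _*_ (f≡g n ≤-refl) (∏<-cong n (λ i i<n → f≡g i (m<n⇒m<1+n i<n)))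

  ∑<-distrib-+ : ∀ n f g → ∑< n (λ i → f i + g i) ≡ ∑< n f + ∑< n g
  ∑<-distrib-+ zero    f g = refl
  ∑<-distrib-+ (suc n) f g = trans (cong (f n + g n +_) (∑<-distrib-+ n f g)) (interchange (f n) (g n) (∑< n f) (∑< n g))
    where
    interchange : ∀ a b c d → a + b + (c + d) ≡ a + c + (b + d)
    interchange = solve-∀

  ∑<-const : ∀ n c → ∑< n (λ _ → c) ≡ n * c
  ∑<-const zero    c = refl
  ∑<-const (suc n) c = cong (c +_) (∑<-const n c)

  ∑<-comm : ∀ m n (h : ℕ → ℕ → ℕ) → ∑< m (λ j → ∑< n (λ i → h i j)) ≡ ∑< n (λ i → ∑< m (λ j → h i j))
  ∑<-comm zero    n h = sym (trans (∑<-const n 0) (*-zeroʳ n))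
  ∑<-comm (suc m) n h = trans (cong (∑< n (λ i → h i m) +_) (∑<-comm m n h))
                              (sym (∑<-distrib-+ n (λ i → h i m) (λ i → ∑< m (h i))))

  ∑<≡0⇒≡0 : ∀ n f → ∑< n f ≡ 0 → ∀ i → i < n → f i ≡ 0
  ∑<≡0⇒≡0 (suc n) f ∑≡0 i i<1+n with i ℕ.≟ n
  ... | yes refl = m+n≡0⇒m≡0 (f i) ∑≡0
  ... | no i≢n   = ∑<≡0⇒≡0 n f (m+n≡0⇒n≡0 (f n) ∑≡0) i (≤∧≢⇒< (≤-pred i<1+n) i≢n)

  ∏<-split : ∀ k m f → ∏< (k + m) f ≡ ∏< m (λ i → f (k + i)) * ∏< k f
  ∏<-split k zero    f = trans (cong (λ n → ∏< n f) (+-identityʳ k)) (sym (+-identityʳ (∏< k f)))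
  ∏<-split k (suc m) f = begin
    ∏< (k + suc m) f                                   ≡⟨ cong (λ n → ∏< n f) (+-suc k m) ⟩
    f (k + m) * ∏< (k + m) f                           ≡⟨ cong (f (k + m) *_) (∏<-split k m f) ⟩
    f (k + m) * (∏< m (λ i → f (k + i)) * ∏< k f)     ≡⟨ sym (*-assoc (f (k + m)) _ _) ⟩
    ∏< (suc m) (λ i → f (k + i)) * ∏< k f             ∎
    where open ≡-Reasoning

  multiples : ℕ → ℕ → ℕ
  multiples n X = ∑< X (λ j → 𝟙 (n ∣? suc j))

  multiples-remainder : ∀ n X → 1 ≤ n → ∃ λ r → r < n × multiples n X * n + r ≡ X
  multiples-remainder n zero    1≤n = 0 , 1≤n , refl
  multiples-remainder n (suc X) 1≤n with multiples-remainder n X 1≤n | n ∣? suc X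
  ... | r , r<n , cn+r≡X | yes n∣1+X = 0 , 1≤n , (begin
    (1 + c) * n + 0  ≡⟨ +-identityʳ _ ⟩
    n + c * n        ≡⟨ cong (_+ c * n) (sym 1+r≡n) ⟩
    suc r + c * n    ≡⟨ +-comm (suc r) (c * n) ⟩
    c * n + suc r    ≡⟨ sym 1+X≡cn+1+r ⟩
    suc X            ∎)
    where
    open ≡-Reasoning
    c : ℕ
    c = multiples n X
    1+X≡cn+1+r : suc X ≡ c * n + suc r
    1+X≡cn+1+r = trans (cong suc (sym cn+r≡X)) (sym (+-suc (c * n) r))
    1+r≡n : suc r ≡ n
    1+r≡n = ≤-antisym r<n (∣⇒≤ (∣m+n∣m⇒∣n (subst (n ∣_) 1+X≡cn+1+r n∣1+X) (n∣m*n c)))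
  ... | r , r<n , cn+r≡X | no n∤1+X = suc r , ≤∧≢⇒< r<n 1+r≢n , trans (+-suc (c * n) r) (cong suc cn+r≡X)
    where
    c : ℕ
    c = multiples n X
    1+r≢n : suc r ≢ n
    1+r≢n refl = n∤1+X (divides (suc c) (trans (cong suc (sym cn+r≡X))
                                          (trans (sym (+-suc (c * n) r)) (+-comm (c * n) (suc r)))))

  multiples*n≤ : ∀ n X → 1 ≤ n → multiples n X * n ≤ X
  multiples*n≤ n X 1≤n with multiples-remainder n X 1≤n
  ... | r , _ , cn+r≡X = subst (multiples n X * n ≤_) cn+r≡X (m≤m+n _ r)

  ∑<-𝟙-≡-0 : ∀ X c → X < c → ∑< X (λ j → 𝟙 (suc j ℕ.≟ c)) ≡ 0
  ∑<-𝟙-≡-0 zero    c _   = refl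
  ∑<-𝟙-≡-0 (suc X) c X<c with suc X ℕ.≟ c
  ... | yes refl = ⊥-elim (<-irrefl refl X<c)
  ... | no _     = ∑<-𝟙-≡-0 X c (<-trans (n<1+n X) X<c)

  ∑<-𝟙-≡-≤1 : ∀ X c → ∑< X (λ j → 𝟙 (suc j ℕ.≟ c)) ≤ 1
  ∑<-𝟙-≡-≤1 zero    c = z≤n
  ∑<-𝟙-≡-≤1 (suc X) c with suc X ℕ.≟ c
  ... | yes refl = ≤-reflexive (cong suc (∑<-𝟙-≡-0 X (suc X) ≤-refl))
  ... | no _     = ∑<-𝟙-≡-≤1 X c

  𝟙-∈-∷ : ∀ y x xs → 𝟙 (y ∈? x ∷ xs) ≤ 𝟙 (y ℕ.≟ x) + 𝟙 (y ∈? xs)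
  𝟙-∈-∷ y x xs with y ℕ.≟ x | y ∈? xs
  ... | yes _ | _     = s≤s z≤n
  ... | no _  | yes _ = ≤-refl
  ... | no _  | no _  = z≤n

  ∑<-𝟙-∈-≤-length : ∀ X xs → ∑< X (λ j → 𝟙 (suc j ∈? xs)) ≤ length xs
  ∑<-𝟙-∈-≤-length X []       = ≤-reflexive (trans (∑<-const X 0) (*-zeroʳ X))
  ∑<-𝟙-∈-≤-length X (x ∷ xs) = begin
    ∑< X (λ j → 𝟙 (suc j ∈? x ∷ xs))                              ≤⟨ ∑<-mono-≤ X (λ j _ → 𝟙-∈-∷ (suc j) x xs) ⟩
    ∑< X (λ j → 𝟙 (suc j ℕ.≟ x) + 𝟙 (suc j ∈? xs))                ≡⟨ ∑<-distrib-+ X _ _ ⟩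
    ∑< X (λ j → 𝟙 (suc j ℕ.≟ x)) + ∑< X (λ j → 𝟙 (suc j ∈? xs))   ≤⟨ +-mono-≤ (∑<-𝟙-≡-≤1 X x) (∑<-𝟙-∈-≤-length X xs) ⟩
    suc (length xs)                                                ∎
    where open ≤-Reasoning

  prime⇒≥2 : ∀ {p} → Prime p → 2 ≤ p
  prime⇒≥2 {p} p-prime = ℕ.nonTrivial⇒n>1 p {{prime⇒nonTrivial p-prime}}

  ∃-prime-divisor : ∀ n → 2 ≤ n → ∃ λ p → Prime p × p ∣ n
  ∃-prime-divisor n@(suc _) 2≤n with factorise n
  ... | record { factors = [] ; isFactorisation = ∏[]≡n } = ⊥-elim (<-irrefl (sym ∏[]≡n) 2≤n)
  ... | record { factors = p ∷ ps ; isFactorisation = ∏≡n ; factorsPrime = p-prime ∷ _ } =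
    p , p-prime , divides (product ps) (trans ∏≡n (*-comm p (product ps)))

  Smooth : ℕ → ℕ → Set
  Smooth k n = ∀ p → Prime p → p ∣ n → p ≤ k

  smooth-pred : ∀ {k n} → Smooth (suc k) n → (∀ p → Prime p → p ∣ n → p ≢ suc k) → Smooth k n
  smooth-pred smooth p≢1+k p p-prime p∣n = ≤-pred (≤∧≢⇒< (smooth p p-prime p∣n) (p≢1+k p p-prime p∣n))

  subsetProducts : ℕ → List ℕ
  subsetProducts zero    = 1 ∷ []
  subsetProducts (suc k) = subsetProducts k ++ map (suc k *_) (subsetProducts k)

  length-subsetProducts : ∀ k → length (subsetProducts k) ≡ 2 ^ k
  length-subsetProducts zero    = refl
  length-subsetProducts (suc k) = begin
    length (subsetProducts k ++ map (suc k *_) (subsetProducts k))  ≡⟨ length-++ (subsetProducts k) {map (suc k *_) (subsetProducts k)} ⟩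
    length (subsetProducts k) + length (map (suc k *_) (subsetProducts k)) ≡⟨ cong (length (subsetProducts k) +_) (length-map (suc k *_) (subsetProducts k)) ⟩
    length (subsetProducts k) + length (subsetProducts k)            ≡⟨ cong (λ n → n + n) (length-subsetProducts k) ⟩
    2 ^ k + 2 ^ k                                                    ≡⟨ cong (2 ^ k +_) (sym (+-identityʳ (2 ^ k))) ⟩
    2 ^ suc k                                                        ∎
    where open ≡-Reasoning

  SquareDecomposition : ℕ → ℕ → Set
  SquareDecomposition k n = ∃₂ λ s m → s ∈ subsetProducts k × n ≡ s * (m * m)

  private
    decomposition-suc : ∀ k {n} → SquareDecomposition k n → SquareDecomposition (suc k) n
    decomposition-suc k (s , m , s∈ , n≡sm²) = s , m , ∈-++⁺ˡ s∈ , n≡sm²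

    decomposition-*q : ∀ k {n} → SquareDecomposition k n → SquareDecomposition (suc k) (n * suc k)
    decomposition-*q k (s , m , s∈ , refl) =
      suc k * s , m , ∈-++⁺ʳ (subsetProducts k) (∈-map⁺ (suc k *_) s∈) , rearrange s m (suc k)
      where
      rearrange : ∀ s m q → s * (m * m) * q ≡ q * s * (m * m)
      rearrange = solve-∀

    decomposition-*q² : ∀ {k n} q → SquareDecomposition k n → SquareDecomposition k (n * (q * q))
    decomposition-*q² q (s , m , s∈ , refl) = s , m * q , s∈ , rearrange s m q
      where
      rearrange : ∀ s m q → s * (m * m) * (q * q) ≡ s * (m * q * (m * q))
      rearrange = solve-∀

    ≥1-factor : ∀ {n} a b → n ≡ a * b → 1 ≤ n → 1 ≤ a
    ≥1-factor zero    b refl ()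
    ≥1-factor (suc a) b _    _ = s≤s z≤n

    smooth-decomposition-zero : ∀ n → 1 ≤ n → Smooth 0 n → SquareDecomposition 0 n
    smooth-decomposition-zero (suc zero)    _ _      = 1 , 1 , here refl , refl
    smooth-decomposition-zero (suc (suc n)) _ smooth with ∃-prime-divisor (suc (suc n)) (s≤s (s≤s z≤n))
    ... | p , p-prime , p∣n = ⊥-elim (<⇒≱ (prime⇒≥2 p-prime) (≤-trans (smooth p p-prime p∣n) z≤n))

    -- Strip q = k + 1 from n: first the factors q² (recursion on n, bounded by fuel), then at most one q.
    smooth-decomposition-suc : ∀ k → (∀ n → 1 ≤ n → Smooth k n → SquareDecomposition k n) →
                               ∀ fuel n → n ≤ fuel → 1 ≤ n → Smooth (suc k) n → SquareDecomposition (suc k) n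
    smooth-decomposition-suc k IH zero n n≤0 1≤n _ = ⊥-elim (<⇒≱ 1≤n n≤0)
    smooth-decomposition-suc k IH (suc fuel) n n≤fuel 1≤n smooth with prime? (suc k) | suc k ∣? n
    ... | no ¬q-prime | _ = decomposition-suc k (IH n 1≤n (smooth-pred smooth λ { _ p-prime _ refl → ¬q-prime p-prime }))
    ... | yes _ | no q∤n  = decomposition-suc k (IH n 1≤n (smooth-pred smooth λ { _ _ p∣n refl → q∤n p∣n }))
    ... | yes q-prime | yes (divides n₁ n≡n₁q) with suc k ∣? n₁
    ...   | yes (divides n₂ n₁≡n₂q) =
      subst (SquareDecomposition (suc k)) (sym n≡n₂q²)
        (decomposition-*q² {suc k} q (smooth-decomposition-suc k IH fuel n₂ n₂<fuel 1≤n₂ smooth-n₂))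
      where
      q : ℕ
      q = suc k
      n≡n₂q² : n ≡ n₂ * (q * q)
      n≡n₂q² = trans n≡n₁q (trans (cong (_* q) n₁≡n₂q) (*-assoc n₂ q q))
      1≤n₂ : 1 ≤ n₂
      1≤n₂ = ≥1-factor n₂ (q * q) n≡n₂q² 1≤n
      n₂<fuel : n₂ ≤ fuel
      n₂<fuel = ≤-pred (≤-trans (subst (n₂ <_) (sym n≡n₂q²) (m<m*n n₂ (q * q) {{ℕ.>-nonZero 1≤n₂}} 1<q²)) n≤fuel)
        where
        1<q² : 1 < q * q
        1<q² = ≤-trans (s≤s (s≤s z≤n)) (*-mono-≤ (prime⇒≥2 q-prime) (prime⇒≥2 q-prime))
      smooth-n₂ : Smooth (suc k) n₂
      smooth-n₂ p p-prime p∣n₂ = smooth p p-prime (∣-trans p∣n₂ (divides (q * q) (trans n≡n₂q² (*-comm n₂ (q * q)))))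
    ...   | no q∤n₁ = subst (SquareDecomposition (suc k)) (sym n≡n₁q) (decomposition-*q k (IH n₁ 1≤n₁ smooth-n₁))
      where
      1≤n₁ : 1 ≤ n₁
      1≤n₁ = ≥1-factor n₁ (suc k) n≡n₁q 1≤n
      smooth-n₁ : Smooth k n₁
      smooth-n₁ = smooth-pred (λ p p-prime p∣n₁ → smooth p p-prime (∣-trans p∣n₁ (divides (suc k) (trans n≡n₁q (*-comm n₁ (suc k))))))
                              (λ { _ _ p∣n₁ refl → q∤n₁ p∣n₁ })

  smooth-decomposition : ∀ k n → 1 ≤ n → Smooth k n → SquareDecomposition k n
  smooth-decomposition zero    = smooth-decomposition-zero
  smooth-decomposition (suc k) n = smooth-decomposition-suc k (smooth-decomposition k) n n ≤-refl

  𝟙-yes : ∀ {p} {P : Set p} (P? : Dec P) → P → 𝟙 P? ≡ 1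
  𝟙-yes (yes _) _ = refl
  𝟙-yes (no ¬p) p = ⊥-elim (¬p p)

  primeDivisorsAbove : ℕ → ℕ → ℕ → ℕ
  primeDivisorsAbove k X j = ∑< (X ∸ k) (λ i → 𝟙 (prime? (suc (k + i)) ×-dec suc (k + i) ∣? j))

  primeMultiples : ℕ → ℕ → ℕ
  primeMultiples p X = ∑< X (λ j → 𝟙 (prime? p ×-dec p ∣? suc j))

  primeDivisorsAbove≡0⇒smooth : ∀ k X j → 1 ≤ j → j ≤ X → primeDivisorsAbove k X j ≡ 0 → Smooth k j
  primeDivisorsAbove≡0⇒smooth k X j 1≤j j≤X d≡0 p p-prime p∣j with p ≤? k
  ... | yes p≤k = p≤k
  ... | no  p≰k = ⊥-elim (0≢1+n (trans (sym term≡0) (𝟙-yes (prime? p′ ×-dec p′ ∣? j) (subst Prime p≡p′ p-prime , subst (_∣ j) p≡p′ p∣j))))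
    where
    i : ℕ
    i = p ∸ suc k
    p′ : ℕ
    p′ = suc (k + i)
    p≡p′ : p ≡ p′
    p≡p′ = sym (m+[n∸m]≡n (≰⇒> p≰k))
    i<X∸k : i < X ∸ k
    i<X∸k = m+n≤o⇒m≤o∸n (suc i) (subst (_≤ X) (trans p≡p′ (cong suc (+-comm k i))) (≤-trans (∣⇒≤ {{ℕ.>-nonZero 1≤j}} p∣j) j≤X))
    term≡0 : 𝟙 (prime? p′ ×-dec p′ ∣? j) ≡ 0
    term≡0 = ∑<≡0⇒≡0 (X ∸ k) _ d≡0 i i<X∸k

  squareMultiples : ℕ → List ℕ
  squareMultiples k = cartesianProductWith (λ s i → s * (suc i * suc i)) (subsetProducts k) (upTo (2 ^ suc k))

  length-cartesianProductWith : ∀ {A B C : Set} (f : A → B → C) xs ys →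
                                length (cartesianProductWith f xs ys) ≡ length xs * length ys
  length-cartesianProductWith f []       ys = refl
  length-cartesianProductWith f (x ∷ xs) ys = begin
    length (map (f x) ys ++ cartesianProductWith f xs ys)        ≡⟨ length-++ (map (f x) ys) ⟩
    length (map (f x) ys) + length (cartesianProductWith f xs ys) ≡⟨ cong₂ _+_ (length-map (f x) ys) (length-cartesianProductWith f xs ys) ⟩
    length ys + length xs * length ys                             ∎
    where open ≡-Reasoning

  4^n≡2^n*2^n : ∀ n → 4 ^ n ≡ 2 ^ n * 2 ^ n
  4^n≡2^n*2^n zero    = refl
  4^n≡2^n*2^n (suc n) = trans (cong (4 *_) (4^n≡2^n*2^n n)) (regroup (2 ^ n))
    where
    regroup : ∀ a → 4 * (a * a) ≡ 2 * a * (2 * a)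
    regroup = solve-∀

  smooth⇒∈squareMultiples : ∀ k j → 1 ≤ j → j ≤ 4 ^ suc k → Smooth k j → j ∈ squareMultiples k
  smooth⇒∈squareMultiples k j 1≤j j≤X smooth with smooth-decomposition k j 1≤j smooth
  ... | s , zero  , _  , j≡0 = ⊥-elim (<⇒≱ 1≤j (≤-reflexive (trans j≡0 (*-zeroʳ s))))
  ... | s , suc i , s∈ , refl = ∈-cartesianProductWith⁺ _ s∈ (∈-upTo⁺ i<M)
    where
    M : ℕ
    M = 2 ^ suc k
    i<M : i < M
    i<M with suc i ≤? M
    ... | yes 1+i≤M = 1+i≤M
    ... | no  1+i≰M = ⊥-elim (<⇒≱ (*-mono-< (≰⇒> 1+i≰M) (≰⇒> 1+i≰M)) [1+i]²≤M²)
      where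
      [1+i]²≤M² : suc i * suc i ≤ M * M
      [1+i]²≤M² = ≤-trans (m≤n*m _ s {{ℕ.>-nonZero (≥1-factor s _ refl 1≤j)}}) (≤-trans j≤X (≤-reflexive (4^n≡2^n*2^n (suc k))))

  -- Erdős: at most 2^k · 2^(k+1) numbers up to X = 4^(k+1) are k-smooth, and every other one has a prime divisor in (k, X].
  erdős-count : ∀ k → 4 ^ suc k ≤ 2 * ∑< (4 ^ suc k ∸ k) (λ i → primeMultiples (suc (k + i)) (4 ^ suc k))
  erdős-count k = subst (_≤ 2 * F) (trans (cong (L +_) (+-identityʳ L)) (sym X≡L+L)) (*-monoʳ-≤ 2 L≤F)
    where
    X : ℕ
    X = 4 ^ suc k
    L : ℕ
    L = 2 ^ k * 2 ^ suc k
    F : ℕ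
    F = ∑< (X ∸ k) (λ i → primeMultiples (suc (k + i)) X)
    X≡L+L : X ≡ L + L
    X≡L+L = trans (4^n≡2^n*2^n (suc k)) (double (2 ^ k))
      where
      double : ∀ a → 2 * a * (2 * a) ≡ a * (2 * a) + a * (2 * a)
      double = solve-∀
    length-L : length (squareMultiples k) ≡ L
    length-L = trans (length-cartesianProductWith _ (subsetProducts k) (upTo (2 ^ suc k)))
                     (cong₂ _*_ (length-subsetProducts k) (length-upTo (2 ^ suc k)))
    covered : ∀ j → 1 ≤ j → j ≤ X → 1 ≤ 𝟙 (j ∈? squareMultiples k) + primeDivisorsAbove k X j
    covered j 1≤j j≤X with primeDivisorsAbove k X j ℕ.≟ 0
    ... | no  d≢0 = ≤-trans (n≢0⇒n>0 d≢0) (m≤n+m _ _)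
    ... | yes d≡0 = ≤-trans (≤-reflexive (sym (𝟙-yes (j ∈? squareMultiples k) j∈)))  (m≤m+n _ _)
      where
      j∈ : j ∈ squareMultiples k
      j∈ = smooth⇒∈squareMultiples k j 1≤j j≤X (primeDivisorsAbove≡0⇒smooth k X j 1≤j j≤X d≡0)
    X≤L+F : X ≤ L + F
    X≤L+F = begin
      X                                                            ≡⟨ sym (trans (∑<-const X 1) (*-identityʳ X)) ⟩
      ∑< X (λ _ → 1)                                               ≤⟨ ∑<-mono-≤ X (λ j j<X → covered (suc j) (s≤s z≤n) j<X) ⟩
      ∑< X (λ j → 𝟙 (suc j ∈? squareMultiples k) + primeDivisorsAbove k X (suc j))
                                                                   ≡⟨ ∑<-distrib-+ X _ _ ⟩
      ∑< X (λ j → 𝟙 (suc j ∈? squareMultiples k)) + ∑< X (λ j → primeDivisorsAbove k X (suc j))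
                                                                   ≤⟨ +-mono-≤ (∑<-𝟙-∈-≤-length X (squareMultiples k)) (≤-reflexive (∑<-comm X (X ∸ k) _)) ⟩
      length (squareMultiples k) + F                               ≡⟨ cong (_+ F) length-L ⟩
      L + F                                                        ∎
      where open ≤-Reasoning
    L≤F : L ≤ F
    L≤F = +-cancelˡ-≤ L L F (subst (_≤ L + F) X≡L+L X≤L+F)

  -- ∏ (1 − xᵢ) ≤ 1 / (1 + ∑ xᵢ) for xᵢ = uᵢ / (uᵢ + wᵢ), cleared of denominators and weakened by fᵢ / T ≤ xᵢ.
  ∏-complement-bound : ∀ T m (u w f : ℕ → ℕ) → (∀ i → i < m → f i * (u i + w i) ≤ T * u i) →
                       ∏< m w * (T + ∑< m f) ≤ T * ∏< m (λ i → u i + w i)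
  ∏-complement-bound T zero    u w f _    = ≤-reflexive (trans (+-identityʳ (T + 0)) (trans (+-identityʳ T) (sym (*-identityʳ T))))
  ∏-complement-bound T (suc m) u w f f≤Tu = begin
    w m * A * (T + (f m + F))       ≡⟨ regroup (w m) A (T + (f m + F)) ⟩
    A * (w m * (T + (f m + F)))     ≤⟨ *-monoʳ-≤ A last-factor ⟩
    A * ((u m + w m) * (T + F))     ≡⟨ swap A (u m + w m) (T + F) ⟩
    (u m + w m) * (A * (T + F))     ≤⟨ *-monoʳ-≤ (u m + w m) (∏-complement-bound T m u w f (λ i i<m → f≤Tu i (m<n⇒m<1+n i<m))) ⟩
    (u m + w m) * (T * B)           ≡⟨ swap (u m + w m) T B ⟩
    T * ((u m + w m) * B)           ∎
    where
    open ≤-Reasoning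
    A : ℕ
    A = ∏< m w
    B : ℕ
    B = ∏< m (λ i → u i + w i)
    F : ℕ
    F = ∑< m f
    regroup : ∀ a b c → a * b * c ≡ b * (a * c)
    regroup = solve-∀
    swap : ∀ a b c → a * (b * c) ≡ b * (a * c)
    swap = solve-∀
    wf≤uT+uF : w m * f m ≤ u m * T + u m * F
    wf≤uT+uF = begin
      w m * f m                  ≤⟨ m≤n+m _ (f m * u m) ⟩
      f m * u m + w m * f m      ≡⟨ factor (f m) (u m) (w m) ⟩
      f m * (u m + w m)          ≤⟨ f≤Tu m ≤-refl ⟩
      T * u m                    ≡⟨ *-comm T (u m) ⟩
      u m * T                    ≤⟨ m≤m+n _ _ ⟩
      u m * T + u m * F          ∎
      where
      factor : ∀ f u w → f * u + w * f ≡ f * (u + w)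
      factor = solve-∀
    last-factor : w m * (T + (f m + F)) ≤ (u m + w m) * (T + F)
    last-factor = begin
      w m * (T + (f m + F))                          ≡⟨ expand (w m) T (f m) F ⟩
      (w m * T + w m * F) + w m * f m                ≤⟨ +-monoʳ-≤ (w m * T + w m * F) wf≤uT+uF ⟩
      (w m * T + w m * F) + (u m * T + u m * F)      ≡⟨ collect (u m) (w m) T F ⟩
      (u m + w m) * (T + F)                          ∎
      where
      expand : ∀ w t f F → w * (t + (f + F)) ≡ (w * t + w * F) + w * f
      expand = solve-∀
      collect : ∀ u w t F → (w * t + w * F) + (u * t + u * F) ≡ (u + w) * (t + F)
      collect = solve-∀

  onPrime : ∀ {n} → Dec (Prime n) → ℕ → ℕ → ℕ
  onPrime (yes _) a b = a
  onPrime (no _)  a b = b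

  squareFactor sieveFactor : ℕ → ℕ
  squareFactor n = onPrime (prime? n) (n * n) 1
  sieveFactor  n = onPrime (prime? n) (suc (n * (n ∸ 1))) 1

  ∏p² ∏[p²-p+1] : ℕ → ℕ
  ∏p²       K = ∏< K (λ i → squareFactor (suc i))
  ∏[p²-p+1] K = ∏< K (λ i → sieveFactor (suc i))

  ∏p²≥1 : ∀ K → 1 ≤ ∏p² K
  ∏p²≥1 zero    = ≤-refl
  ∏p²≥1 (suc K) with prime? (suc K)
  ... | yes _ = *-mono-≤ (*-mono-≤ (s≤s (z≤n {K})) (s≤s (z≤n {K}))) (∏p²≥1 K)
  ... | no  _ = subst (1 ≤_) (sym (+-identityʳ (∏p² K))) (∏p²≥1 K)

  private
    [p-1]+[p²-p+1]≡p² : ∀ n (d : Dec (Prime n)) → onPrime d (n ∸ 1) 0 + onPrime d (suc (n * (n ∸ 1))) 1 ≡ onPrime d (n * n) 1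
    [p-1]+[p²-p+1]≡p² n       (no _)  = refl
    [p-1]+[p²-p+1]≡p² zero    (yes p) = ⊥-elim (<⇒≱ (prime⇒≥2 p) z≤n)
    [p-1]+[p²-p+1]≡p² (suc n) (yes _) = identity n
      where
      identity : ∀ n → n + suc (suc n * n) ≡ suc n * suc n
      identity = solve-∀

    2≤n⇒n≤2[n∸1] : ∀ {n} → 2 ≤ n → n ≤ 2 * (n ∸ 1)
    2≤n⇒n≤2[n∸1] {suc zero}    (s≤s ())
    2≤n⇒n≤2[n∸1] {suc (suc m)} _ = ≤-trans (+-monoʳ-≤ 2 (m≤m+n m m)) (≤-reflexive (double m))
      where
      double : ∀ m → 2 + (m + m) ≡ 2 * suc m
      double = solve-∀

    primeMultiples-no : ∀ p X → ¬ Prime p → primeMultiples p X ≡ 0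
    primeMultiples-no p X ¬prime = trans (∑<-cong X (λ j _ → 𝟙-no j)) (trans (∑<-const X 0) (*-zeroʳ X))
      where
      𝟙-no : ∀ j → 𝟙 (prime? p ×-dec p ∣? suc j) ≡ 0
      𝟙-no j with prime? p
      ... | yes p-prime = ⊥-elim (¬prime p-prime)
      ... | no _      = refl

    primeMultiples≤multiples : ∀ p X → primeMultiples p X ≤ multiples p X
    primeMultiples≤multiples p X = ∑<-mono-≤ X (λ j _ → 𝟙-× (prime? p) (p ∣? suc j))
      where
      𝟙-× : ∀ {A B : Set} (A? : Dec A) (B? : Dec B) → 𝟙 (A? ×-dec B?) ≤ 𝟙 B?
      𝟙-× (yes _) (yes _) = ≤-refl
      𝟙-× (yes _) (no _)  = ≤-refl
      𝟙-× (no _)  _       = z≤n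

    -- A prime p has at most X / p multiples up to X, and p ≤ 2 (p − 1).
    primeMultiples-bound : ∀ X n (d : Dec (Prime n)) →
                           primeMultiples n X * (onPrime d (n ∸ 1) 0 + onPrime d (suc (n * (n ∸ 1))) 1) ≤ 2 * X * onPrime d (n ∸ 1) 0
    primeMultiples-bound X n (no ¬prime) = ≤-reflexive (trans (cong (_* 1) (primeMultiples-no n X ¬prime)) (sym (*-zeroʳ (2 * X))))
    primeMultiples-bound X n (yes p-prime) = begin
      c * (n ∸ 1 + suc (n * (n ∸ 1)))  ≡⟨ cong (c *_) ([p-1]+[p²-p+1]≡p² n (yes p-prime)) ⟩
      c * (n * n)                      ≡⟨ sym (*-assoc c n n) ⟩
      c * n * n                        ≤⟨ *-monoˡ-≤ n (≤-trans (*-monoˡ-≤ n (primeMultiples≤multiples n X)) (multiples*n≤ n X 1≤n)) ⟩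
      X * n                            ≤⟨ *-monoʳ-≤ X n≤2[n-1] ⟩
      X * (2 * (n ∸ 1))                ≡⟨ regroup X (n ∸ 1) ⟩
      2 * X * (n ∸ 1)                  ∎
      where
      open ≤-Reasoning
      c : ℕ
      c = primeMultiples n X
      1≤n : 1 ≤ n
      1≤n = ≤-trans (s≤s z≤n) (prime⇒≥2 p-prime)
      n≤2[n-1] : n ≤ 2 * (n ∸ 1)
      n≤2[n-1] = 2≤n⇒n≤2[n∸1] (prime⇒≥2 p-prime)
      regroup : ∀ X m → X * (2 * m) ≡ 2 * X * m
      regroup = solve-∀

  sieve-block : ∀ k → 5 * ∏< (4 ^ suc k ∸ k) (λ i → sieveFactor (suc (k + i)))
                    ≤ 4 * ∏< (4 ^ suc k ∸ k) (λ i → squareFactor (suc (k + i)))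
  sieve-block k = *-cancelʳ-≤ (5 * A) (4 * B) X {{ℕ.>-nonZero (m^n>0 4 (suc k))}} (begin
    5 * A * X              ≡⟨ regroup₁ A X ⟩
    A * (5 * X)            ≤⟨ *-monoʳ-≤ A 5X≤4X+2F ⟩
    A * (4 * X + 2 * F)    ≡⟨ regroup₂ A X F ⟩
    2 * (A * (2 * X + F))  ≤⟨ *-monoʳ-≤ 2 A[2X+F]≤2XB ⟩
    2 * (2 * X * B)        ≡⟨ regroup₃ X B ⟩
    4 * B * X              ∎)
    where
    open ≤-Reasoning
    X : ℕ
    X = 4 ^ suc k
    m : ℕ
    m = X ∸ k
    p : ℕ → ℕ
    p i = suc (k + i)
    A : ℕ
    A = ∏< m (λ i → sieveFactor (p i))
    B : ℕ
    B = ∏< m (λ i → squareFactor (p i))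
    F : ℕ
    F = ∑< m (λ i → primeMultiples (p i) X)
    A[2X+F]≤2XB : A * (2 * X + F) ≤ 2 * X * B
    A[2X+F]≤2XB = subst (λ b → A * (2 * X + F) ≤ 2 * X * b)
      (∏<-cong m (λ i _ → [p-1]+[p²-p+1]≡p² (p i) (prime? (p i))))
      (∏-complement-bound (2 * X) m (λ i → onPrime (prime? (p i)) (p i ∸ 1) 0) (λ i → sieveFactor (p i))
         (λ i → primeMultiples (p i) X) (λ i _ → primeMultiples-bound X (p i) (prime? (p i))))
    5X≤4X+2F : 5 * X ≤ 4 * X + 2 * F
    5X≤4X+2F = subst (_≤ 4 * X + 2 * F) (sym (split X)) (+-monoʳ-≤ (4 * X) (erdős-count k))
      where
      split : ∀ X → 5 * X ≡ 4 * X + X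
      split = solve-∀
    regroup₁ : ∀ A X → 5 * A * X ≡ A * (5 * X)
    regroup₁ = solve-∀
    regroup₂ : ∀ A X F → A * (4 * X + 2 * F) ≡ 2 * (A * (2 * X + F))
    regroup₂ = solve-∀
    regroup₃ : ∀ X B → 2 * (2 * X * B) ≡ 4 * B * X
    regroup₃ = solve-∀

  n<4^[1+n] : ∀ n → n < 4 ^ suc n
  n<4^[1+n] zero    = s≤s z≤n
  n<4^[1+n] (suc n) = begin-strict
    suc n              <⟨ s≤s (n<4^[1+n] n) ⟩
    suc (4 ^ suc n)    ≤⟨ +-monoˡ-≤ (4 ^ suc n) (m^n>0 4 (suc n)) ⟩
    4 ^ suc n + 4 ^ suc n   ≤⟨ +-monoʳ-≤ (4 ^ suc n) (m≤m+n (4 ^ suc n) _) ⟩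
    4 ^ suc (suc n)    ∎
    where open ≤-Reasoning

  tower : ℕ → ℕ
  tower zero    = 0
  tower (suc j) = 4 ^ suc (tower j)

  tower-bound : ∀ j → 5 ^ j * ∏[p²-p+1] (tower j) ≤ 4 ^ j * ∏p² (tower j)
  tower-bound zero    = ≤-refl
  tower-bound (suc j) = begin
    5 ^ suc j * ∏[p²-p+1] (tower (suc j))  ≡⟨ cong (λ K → 5 ^ suc j * ∏[p²-p+1] K) tower≡k+m ⟩
    5 ^ suc j * ∏[p²-p+1] (k + m)          ≡⟨ cong (λ w → 5 ^ suc j * w) (∏<-split k m (λ i → sieveFactor (suc i))) ⟩
    5 * 5 ^ j * (A * ∏[p²-p+1] k)          ≡⟨ interchange 5 (5 ^ j) A (∏[p²-p+1] k) ⟩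
    5 * A * (5 ^ j * ∏[p²-p+1] k)          ≤⟨ *-mono-≤ (sieve-block k) (tower-bound j) ⟩
    4 * B * (4 ^ j * ∏p² k)                ≡⟨ interchange 4 B (4 ^ j) (∏p² k) ⟩
    4 * 4 ^ j * (B * ∏p² k)                ≡⟨ cong (λ w → 4 ^ suc j * w) (∏<-split k m (λ i → squareFactor (suc i))) ⟨
    4 ^ suc j * ∏p² (k + m)                ≡⟨ cong (λ K → 4 ^ suc j * ∏p² K) tower≡k+m ⟨
    4 ^ suc j * ∏p² (tower (suc j))        ∎
    where
    open ≤-Reasoning
    k : ℕ
    k = tower j
    m : ℕ
    m = 4 ^ suc k ∸ k
    tower≡k+m : tower (suc j) ≡ k + m
    tower≡k+m = sym (m+[n∸m]≡n (<⇒≤ (n<4^[1+n] k)))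
    A : ℕ
    A = ∏< m (λ i → sieveFactor (suc (k + i)))
    B : ℕ
    B = ∏< m (λ i → squareFactor (suc (k + i)))
    interchange : ∀ a b c d → a * b * (c * d) ≡ a * c * (b * d)
    interchange = solve-∀

  bernoulli : ∀ j → (4 + j) * 4 ^ j ≤ 4 * 5 ^ j
  bernoulli zero    = ≤-refl
  bernoulli (suc j) = begin
    (4 + suc j) * (4 * 4 ^ j)                  ≤⟨ m≤m+n _ (j * 4 ^ j) ⟩
    (4 + suc j) * (4 * 4 ^ j) + j * 4 ^ j      ≡⟨ expand j (4 ^ j) ⟩
    5 * ((4 + j) * 4 ^ j)                      ≤⟨ *-monoʳ-≤ 5 (bernoulli j) ⟩
    5 * (4 * 5 ^ j)                            ≡⟨ *-comm 5 (4 * 5 ^ j) ⟩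
    4 * 5 ^ j * 5                              ≡⟨ *-assoc 4 (5 ^ j) 5 ⟩
    4 * (5 ^ j * 5)                            ≡⟨ cong (4 *_) (*-comm (5 ^ j) 5) ⟩
    4 * 5 ^ suc j                              ∎
    where
    open ≤-Reasoning
    expand : ∀ j a → (4 + suc j) * (4 * a) + j * a ≡ 5 * ((4 + j) * a)
    expand = solve-∀

  ∏[p²-p+1]/∏p²→0 : ∀ N → ∃ λ K → N * ∏[p²-p+1] K ≤ ∏p² K
  ∏[p²-p+1]/∏p²→0 N = K , *-cancelˡ-≤ (4 ^ j) {{ℕ.>-nonZero (m^n>0 4 j)}} (begin
    4 ^ j * (N * ∏[p²-p+1] K)   ≡⟨ *-assoc (4 ^ j) N _ ⟨
    4 ^ j * N * ∏[p²-p+1] K     ≤⟨ *-monoˡ-≤ (∏[p²-p+1] K) 4^jN≤5^j ⟩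
    5 ^ j * ∏[p²-p+1] K         ≤⟨ tower-bound j ⟩
    4 ^ j * ∏p² K               ∎)
    where
    open ≤-Reasoning
    j : ℕ
    j = 4 * N
    K : ℕ
    K = tower j
    4^jN≤5^j : 4 ^ j * N ≤ 5 ^ j
    4^jN≤5^j = *-cancelˡ-≤ 4 (begin
      4 * (4 ^ j * N)               ≡⟨ regroup N (4 ^ j) ⟩
      j * 4 ^ j                     ≤⟨ m≤m+n _ (4 * 4 ^ j) ⟩
      j * 4 ^ j + 4 * 4 ^ j         ≡⟨ *-distribʳ-+ (4 ^ j) j 4 ⟨
      (j + 4) * 4 ^ j               ≡⟨ cong (_* 4 ^ j) (+-comm j 4) ⟩
      (4 + j) * 4 ^ j               ≤⟨ bernoulli j ⟩
      4 * 5 ^ j                     ∎)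
      where
      regroup : ∀ N a → 4 * (a * N) ≡ (4 * N) * a
      regroup = solve-∀

open PrimeProductDivergence using (prime⇒≥2; ∏p²; ∏[p²-p+1]; ∏p²≥1; ∏[p²-p+1]/∏p²→0)

NoPrimeFactor≤ : ℕ → ℕ → Set
NoPrimeFactor≤ K a = ∀ q → Prime q → q ℕ.≤ K → ¬ (q ℕ.∣ a)

noPrimeFactor≤-1 : ∀ K → NoPrimeFactor≤ K 1
noPrimeFactor≤-1 K q q-prime _ q∣1 = ℕ.<⇒≱ (prime⇒≥2 q-prime) (ℕ.∣⇒≤ q∣1)

noPrimeFactor≤-pred : ∀ {K a} → NoPrimeFactor≤ (suc K) a → NoPrimeFactor≤ K a
noPrimeFactor≤-pred none q q-prime q≤K = none q q-prime (ℕ.m≤n⇒m≤1+n q≤K)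

noPrimeFactor≤-* : ∀ {K a m} → NoPrimeFactor≤ K a → NoPrimeFactor≤ K m → NoPrimeFactor≤ K (a ℕ.* m)
noPrimeFactor≤-* {a = a} {m} none-a none-m q q-prime q≤K q∣am with euclidsLemma a m q-prime q∣am
... | inj₁ q∣a = none-a q q-prime q≤K q∣a
... | inj₂ q∣m = none-m q q-prime q≤K q∣m

prime⇒noPrimeFactor≤pred : ∀ {K} → Prime (suc K) → NoPrimeFactor≤ K (suc K)
prime⇒noPrimeFactor≤pred 1+K-prime q q-prime q≤K q∣1+K with prime⇒irreducible 1+K-prime q∣1+K
... | inj₁ refl = ℕ.<⇒≱ (prime⇒≥2 q-prime) ℕ.≤-refl
... | inj₂ refl = ℕ.<-irrefl refl q≤K

record IntegerEmbedding (dom : Domain) : Set where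
  open Domain dom
  field
    ι       : H → ℤ
    ι-scale : ∀ k x → ι (scale k x) ≡ ℤ.+ k ℤ.* ι x
    ι-shift : ∀ h x → ι (shift h x) ≡ ι x ℤ.+ ℤ.+ h

module Sieve
  (dom : Domain) (division : AffineMaps.DivisionWithRemainder dom) (embedding : IntegerEmbedding dom)
  (R : CompleteOrderedField) {μ : Pred (Domain.H dom) 0ℓ → CompleteOrderedField.Carrier R}
  (isμ : Domain.IsUpperQuasiDensity dom R μ) where

  open import Data.Integer using (+_; _+_; _*_)
  open import Data.Integer.Divisibility.Signed using (_∣_; divides; ∣⇒∣ᵤ; ∣ᵤ⇒∣; ∣m+n∣m⇒∣n; ∣m⇒∣m*n; ∣-refl)
  open import Data.Integer.Tactic.RingSolver using (solve-∀)
  import Data.Nat.Tactic.RingSolver as ℕ-Solver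

  open Domain dom
  open AffineMaps dom
  open IntegerEmbedding embedding
  open LinearCongruence
  open CompleteOrderedField R renaming (_+_ to _+ᴿ_; _*_ to _*ᴿ_)
  open OrderedFieldProperties R
  open QuasiDensityProperties dom division R isμ
  open IsUpperQuasiDensity isμ

  ι-affine : ∀ m r z → ι (affine m r z) ≡ + m * ι z + + r
  ι-affine m r z = trans (ι-shift r (scale m z)) (cong (_+ + r) (ι-scale m z))

  Squareful : ℕ → ℕ → ℤ → Pred H 0ℓ → Set
  Squareful q a b Y = ∀ y → Y y → + q ∣ + a * ι y + b → + (q ℕ.* q) ∣ + a * ι y + b

  SquarefulUpTo : ℕ → ℕ → ℤ → Pred H 0ℓ → Set
  SquarefulUpTo K a b Y = ∀ q → Prime q → q ℕ.≤ K → Squareful q a b Y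

  a[mz+r]+b≡[am]z+[ar+b] : ∀ a b m r z → + a * ι (affine m r z) + b ≡ + (a ℕ.* m) * ι z + (+ a * + r + b)
  a[mz+r]+b≡[am]z+[ar+b] a b m r z = begin
    + a * ι (affine m r z) + b           ≡⟨ cong (λ w → + a * w + b) (ι-affine m r z) ⟩
    + a * (+ m * ι z + + r) + b          ≡⟨ distribute (+ a) (+ m) (ι z) (+ r) b ⟩
    + a * + m * ι z + (+ a * + r + b)    ≡⟨ cong (λ w → w * ι z + (+ a * + r + b)) (ℤ.pos-* a m) ⟨
    + (a ℕ.* m) * ι z + (+ a * + r + b)  ∎
    where
    open ≡-Reasoning
    distribute : ∀ a m z r b → a * (m * z + r) + b ≡ a * m * z + (a * r + b)
    distribute = solve-∀

  squareful-∘affine : ∀ {q a b Y} m r → Squareful q a b Y → Squareful q (a ℕ.* m) (+ a * + r + b) (Y ∘ affine m r)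
  squareful-∘affine {q} {a} {b} m r squareful z Y[mz+r] q∣ =
    subst (+ (q ℕ.* q) ∣_) eq (squareful _ Y[mz+r] (subst (+ q ∣_) (sym eq) q∣))
    where
    eq : + a * ι (affine m r z) + b ≡ + (a ℕ.* m) * ι z + (+ a * + r + b)
    eq = a[mz+r]+b≡[am]z+[ar+b] a b m r z

  -- If q ∣ a t₀ + b = c q, then a (q (q w + s) + t₀) + b = q (q a w + a s + c), and q² divides
  -- this only if q ∣ a s + c.
  squareful-residue : ∀ {q a b Y t₀ c s w} → 1 ℕ.≤ q → Squareful q a b Y → + a * + t₀ + b ≡ c * + q →
                      (Y ∘ affine q t₀ ∘ affine q s) w → + q ∣ + a * + s + c
  squareful-residue {q} {a} {b} {Y} {t₀} {c} {s} {w} 1≤q squareful at₀+b≡cq Yw =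
    ∣m+n∣m⇒∣n q∣qaw+as+c (∣m⇒∣m*n (+ a * ι w) ∣-refl)
    where
    open ≡-Reasoning
    Q : ℤ
    Q = + q * (+ a * ι w) + (+ a * + s + c)
    value≡Qq : + a * ι (affine q t₀ (affine q s w)) + b ≡ Q * + q
    value≡Qq = begin
      + a * ι (affine q t₀ (affine q s w)) + b                 ≡⟨ a[mz+r]+b≡[am]z+[ar+b] a b q t₀ _ ⟩
      + (a ℕ.* q) * ι (affine q s w) + (+ a * + t₀ + b)        ≡⟨ cong₂ (λ u v → u * ι (affine q s w) + v) (ℤ.pos-* a q) at₀+b≡cq ⟩
      + a * + q * ι (affine q s w) + c * + q                   ≡⟨ cong (λ u → + a * + q * u + c * + q) (ι-affine q s w) ⟩
      + a * + q * (+ q * ι w + + s) + c * + q                  ≡⟨ factor (+ a) (+ q) (ι w) (+ s) c ⟩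
      Q * + q                                                  ∎
      where
      factor : ∀ a q w s c → a * q * (q * w + s) + c * q ≡ (q * (a * w) + (a * s + c)) * q
      factor = solve-∀
    q²∣Qq : (q ℕ.* q) ℕ.∣ ℤ.∣ Q ∣ ℕ.* q
    q²∣Qq = subst ((q ℕ.* q) ℕ.∣_) (trans (cong ℤ.∣_∣ value≡Qq) (ℤ.abs-* Q (+ q)))
              (∣⇒∣ᵤ (squareful _ Yw (divides Q value≡Qq)))
    q∣qaw+as+c : + q ∣ Q
    q∣qaw+as+c = ∣ᵤ⇒∣ (ℕ.*-cancelʳ-∣ q {{ℕ.>-nonZero 1≤q}} q²∣Qq)

  SieveBound : ℕ → ℕ → ℕ → Set₁
  SieveBound K D W = ∀ a b Y → NoPrimeFactor≤ K a → SquarefulUpTo K a b Y → fromℕ D *ᴿ μ Y ≤ fromℕ W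

  sieveBound-zero : SieveBound 0 1 1
  sieveBound-zero a b Y _ _ = subst₂ _≤_ (sym (trans (cong (_*ᴿ μ Y) fromℕ-1) (*-identityˡ (μ Y)))) (sym fromℕ-1) (bounded Y)

  sieveBound-suc : ∀ {K D W} → SieveBound K D W → SieveBound (suc K) D W
  sieveBound-suc bound a b Y none squareful =
    bound a b Y (noPrimeFactor≤-pred none) (λ q q-prime q≤K → squareful q q-prime (ℕ.m≤n⇒m≤1+n q≤K))

  -- For a prime q = K + 1 split Y into residue classes mod q: exactly one class t₀ has q ∣ a t₀ + b,
  -- and within it only one class mod q² survives; the other q − 1 classes are bounded by induction.
  module SievePrimeStep {K D W} (q-prime : Prime (suc K)) (bound : SieveBound K D W)
                        {a b Y} (none : NoPrimeFactor≤ (suc K) a) (squareful : SquarefulUpTo (suc K) a b Y) where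

    open ≤-Reasoning

    q : ℕ
    q = suc K

    1≤q : 1 ℕ.≤ q
    1≤q = ℕ.s≤s ℕ.z≤n

    q∤a : ¬ (q ℕ.∣ a)
    q∤a = none q q-prime ℕ.≤-refl

    none-*q : ∀ {a′} → NoPrimeFactor≤ K a′ → NoPrimeFactor≤ K (a′ ℕ.* q)
    none-*q none′ = noPrimeFactor≤-* none′ (prime⇒noPrimeFactor≤pred q-prime)

    squareful-K : SquarefulUpTo K a b Y
    squareful-K q′ q′-prime q′≤K = squareful q′ q′-prime (ℕ.m≤n⇒m≤1+n q′≤K)

    class-bound : ∀ t → fromℕ D *ᴿ μ (Y ∘ affine q t) ≤ fromℕ W
    class-bound t = bound (a ℕ.* q) (+ a * + t + b) (Y ∘ affine q t) (none-*q (noPrimeFactor≤-pred none))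
                      (λ q′ q′-prime q′≤K → squareful-∘affine {q′} {a} {b} {Y} q t (squareful-K q′ q′-prime q′≤K))

    special-class-bound : ∀ {t₀ c s₀} → + a * + t₀ + b ≡ c * + q → s₀ ℕ.< q → + q ∣ + a * + s₀ + c →
                          fromℕ q *ᴿ (fromℕ D *ᴿ μ (Y ∘ affine q t₀)) ≤ fromℕ W
    special-class-bound {t₀} {c} {s₀} at₀+b≡cq s₀<q q∣as₀+c = begin
      fromℕ q *ᴿ (fromℕ D *ᴿ μ Y₀)                ≡⟨ x*[y*z]≡y*[x*z] (fromℕ q) (fromℕ D) (μ Y₀) ⟩
      fromℕ D *ᴿ (fromℕ q *ᴿ μ Y₀)                ≤⟨ *-monoʳ-≤-nonNeg (fromℕ D) (fromℕ-nonNeg D) (μ-residue-split q Y₀ 1≤q) ⟩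
      fromℕ D *ᴿ ∑ q (λ s → μ (Y₀ ∘ affine q s))  ≡⟨ *-distribˡ-∑ (fromℕ D) q (λ s → μ (Y₀ ∘ affine q s)) ⟩
      ∑ q (λ s → fromℕ D *ᴿ μ (Y₀ ∘ affine q s))  ≤⟨ ∑-≤-except q (λ s → fromℕ D *ᴿ μ (Y₀ ∘ affine q s)) 0# (fromℕ W)
                                                       s₀ s₀<q other-class surviving-class ⟩
      fromℕ K *ᴿ 0# +ᴿ fromℕ W                    ≡⟨ cong (_+ᴿ fromℕ W) (*-zeroʳ (fromℕ K)) ⟩
      0# +ᴿ fromℕ W                               ≡⟨ +-identityˡ (fromℕ W) ⟩
      fromℕ W                                     ∎
      where
      Y₀ : Pred H 0ℓ
      Y₀ = Y ∘ affine q t₀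
      other-class : ∀ s → s ℕ.< q → s ≢ s₀ → fromℕ D *ᴿ μ (Y₀ ∘ affine q s) ≤ 0#
      other-class s s<q s≢s₀ =
        subst (_≤ 0#) (sym (trans (cong (fromℕ D *ᴿ_) (μ-empty (Y₀ ∘ affine q s) empty)) (*-zeroʳ (fromℕ D)))) (≤-refl 0#)
        where
        empty : ∀ w → ¬ (Y₀ ∘ affine q s) w
        empty w Yw = s≢s₀ (congruence-unique q-prime q∤a c s<q s₀<q
          (squareful-residue {q} {a} {b} {Y} {t₀} {c} {s} {w} 1≤q (squareful q q-prime ℕ.≤-refl) at₀+b≡cq Yw) q∣as₀+c)
      surviving-class : fromℕ D *ᴿ μ (Y₀ ∘ affine q s₀) ≤ fromℕ W
      surviving-class = bound (a ℕ.* q ℕ.* q) (+ (a ℕ.* q) * + s₀ + (+ a * + t₀ + b)) (Y₀ ∘ affine q s₀)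
        (none-*q (none-*q (noPrimeFactor≤-pred none)))
        (λ q′ q′-prime q′≤K → squareful-∘affine {q′} {a ℕ.* q} {+ a * + t₀ + b} {Y₀} q s₀
                                 (squareful-∘affine {q′} {a} {b} {Y} q t₀ (squareful-K q′ q′-prime q′≤K)))

    prime-step-at : ∀ {t₀} → t₀ ℕ.< q → + q ∣ + a * + t₀ + b → fromℕ (q ℕ.* q ℕ.* D) *ᴿ μ Y ≤ fromℕ (suc (q ℕ.* K) ℕ.* W)
    prime-step-at {t₀} t₀<q (divides c at₀+b≡cq) = begin
      fromℕ (q ℕ.* q ℕ.* D) *ᴿ μ Y                    ≡⟨ cong (_*ᴿ μ Y) fromℕ-q²D ⟩
      (fq *ᴿ fD) *ᴿ fq *ᴿ μ Y                         ≡⟨ *-assoc (fq *ᴿ fD) fq (μ Y) ⟩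
      (fq *ᴿ fD) *ᴿ (fq *ᴿ μ Y)                       ≤⟨ *-monoʳ-≤-nonNeg (fq *ᴿ fD) (*-nonneg (fromℕ-nonNeg q) (fromℕ-nonNeg D))
                                                           (μ-residue-split q Y 1≤q) ⟩
      (fq *ᴿ fD) *ᴿ ∑ q (λ t → μ (Y ∘ affine q t))    ≡⟨ *-distribˡ-∑ (fq *ᴿ fD) q (λ t → μ (Y ∘ affine q t)) ⟩
      ∑ q (λ t → (fq *ᴿ fD) *ᴿ μ (Y ∘ affine q t))    ≤⟨ ∑-≤-except q (λ t → (fq *ᴿ fD) *ᴿ μ (Y ∘ affine q t)) (fq *ᴿ fW) fW
                                                           t₀ t₀<q other-class special-class ⟩
      fromℕ K *ᴿ (fq *ᴿ fW) +ᴿ fW                     ≡⟨ fromℕ-[qK+1]W ⟨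
      fromℕ (suc (q ℕ.* K) ℕ.* W)                     ∎
      where
      fq fD fW : Carrier
      fq = fromℕ q
      fD = fromℕ D
      fW = fromℕ W
      other-class : ∀ t → t ℕ.< q → t ≢ t₀ → (fq *ᴿ fD) *ᴿ μ (Y ∘ affine q t) ≤ fq *ᴿ fW
      other-class t _ _ = subst (_≤ fq *ᴿ fW) (sym (*-assoc fq fD (μ (Y ∘ affine q t))))
                                (*-monoʳ-≤-nonNeg fq (fromℕ-nonNeg q) (class-bound t))
      special-class : (fq *ᴿ fD) *ᴿ μ (Y ∘ affine q t₀) ≤ fW
      special-class =
        let s₀ , s₀<q , q∣as₀+c = congruence-solvable q-prime q∤a c
        in subst (_≤ fW) (sym (*-assoc fq fD (μ (Y ∘ affine q t₀)))) (special-class-bound at₀+b≡cq s₀<q q∣as₀+c)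
      fromℕ-q²D : fromℕ (q ℕ.* q ℕ.* D) ≡ (fq *ᴿ fD) *ᴿ fq
      fromℕ-q²D = begin-equality
        fromℕ (q ℕ.* q ℕ.* D)   ≡⟨ trans (fromℕ-* (q ℕ.* q) D) (cong (_*ᴿ fD) (fromℕ-* q q)) ⟩
        fq *ᴿ fq *ᴿ fD          ≡⟨ *-assoc fq fq fD ⟩
        fq *ᴿ (fq *ᴿ fD)        ≡⟨ *-comm fq (fq *ᴿ fD) ⟩
        (fq *ᴿ fD) *ᴿ fq        ∎
      fromℕ-[qK+1]W : fromℕ (suc (q ℕ.* K) ℕ.* W) ≡ fromℕ K *ᴿ (fq *ᴿ fW) +ᴿ fW
      fromℕ-[qK+1]W = begin-equality
        fromℕ (suc (q ℕ.* K) ℕ.* W)          ≡⟨ cong fromℕ (expand K W) ⟩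
        fromℕ (K ℕ.* (q ℕ.* W) ℕ.+ W)        ≡⟨ fromℕ-+ (K ℕ.* (q ℕ.* W)) W ⟩
        fromℕ (K ℕ.* (q ℕ.* W)) +ᴿ fW        ≡⟨ cong (_+ᴿ fW) (trans (fromℕ-* K (q ℕ.* W)) (cong (fromℕ K *ᴿ_) (fromℕ-* q W))) ⟩
        fromℕ K *ᴿ (fq *ᴿ fW) +ᴿ fW          ∎
        where
        expand : ∀ K W → suc (suc K ℕ.* K) ℕ.* W ≡ K ℕ.* (suc K ℕ.* W) ℕ.+ W
        expand = ℕ-Solver.solve-∀

    prime-step : fromℕ (q ℕ.* q ℕ.* D) *ᴿ μ Y ≤ fromℕ (suc (q ℕ.* K) ℕ.* W)
    prime-step = let t₀ , t₀<q , q∣at₀+b = congruence-solvable q-prime q∤a b in prime-step-at t₀<q q∣at₀+b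

  sieveBound : ∀ K → SieveBound K (∏p² K) (∏[p²-p+1] K)
  sieveBound zero    = sieveBound-zero
  sieveBound (suc K) with prime? (suc K)
  ... | yes q-prime = λ a b Y none squareful →
    SievePrimeStep.prime-step {K} {∏p² K} {∏[p²-p+1] K} q-prime (sieveBound K) {a} {b} {Y} none squareful
  ... | no  _       = subst₂ (SieveBound (suc K)) (sym (ℕ.*-identityˡ (∏p² K))) (sym (ℕ.*-identityˡ (∏[p²-p+1] K)))
                        (sieveBound-suc {K} {∏p² K} {∏[p²-p+1] K} (sieveBound K))

prime∣m^n⇒∣m : ∀ {q} m n → Prime q → q ℕ.∣ m ℕ.^ n → q ℕ.∣ m
prime∣m^n⇒∣m m zero    q-prime q∣1 = ⊥-elim (ℕ.<⇒≱ (prime⇒≥2 q-prime) (ℕ.∣⇒≤ q∣1))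
prime∣m^n⇒∣m m (suc n) q-prime q∣m^[1+n] with euclidsLemma m (m ℕ.^ n) q-prime q∣m^[1+n]
... | inj₁ q∣m   = q∣m
... | inj₂ q∣m^n = prime∣m^n⇒∣m m n q-prime q∣m^n

prime∣m^n⇒prime²∣m^n : ∀ {q} m n → Prime q → 2 ℕ.≤ n → q ℕ.∣ m ℕ.^ n → q ℕ.* q ℕ.∣ m ℕ.^ n
prime∣m^n⇒prime²∣m^n m (suc zero)    _       (ℕ.s≤s ()) _
prime∣m^n⇒prime²∣m^n {q} m (suc (suc n)) q-prime _ q∣m^n =
  subst (q ℕ.* q ℕ.∣_) (ℕ.*-assoc m m (m ℕ.^ n)) (ℕ.∣m⇒∣m*n (m ℕ.^ n) (ℕ.*-pres-∣ q∣m q∣m))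
  where
  q∣m : q ℕ.∣ m
  q∣m = prime∣m^n⇒∣m m (suc (suc n)) q-prime q∣m^n

∣i^n∣≡∣i∣^n : ∀ i n → ℤ.∣ i ℤ.^ n ∣ ≡ ℤ.∣ i ∣ ℕ.^ n
∣i^n∣≡∣i∣^n i zero    = refl
∣i^n∣≡∣i∣^n i (suc n) = trans (ℤ.abs-* i (i ℤ.^ n)) (cong (ℤ.∣ i ∣ ℕ.*_) (∣i^n∣≡∣i∣^n i n))

-- Divisibility by q only sees ∣ a y + b ∣, so absolute values of perfect powers suffice.
module PerfectPowerSmallness
  (dom : Domain) (division : AffineMaps.DivisionWithRemainder dom) (embedding : IntegerEmbedding dom)
  (P : Pred (Domain.H dom) 0ℓ)
  (perfect : ∀ y → P y → ∃₂ λ m n → 2 ℕ.≤ n × ℤ.∣ IntegerEmbedding.ι embedding y ∣ ≡ m ℕ.^ n) where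

  open import Data.Integer using (+_)
  open import Data.Integer.Divisibility.Signed using (∣⇒∣ᵤ; ∣ᵤ⇒∣)

  open Domain dom
  open IntegerEmbedding embedding

  small : Small P
  small R μ isμ = archimedean (μ P) (μ-nonNeg P) Nμ≤1
    where
    open CompleteOrderedField R
    open OrderedFieldProperties R
    open QuasiDensityProperties dom division R isμ
    open Sieve dom division embedding R isμ
    open ≤-Reasoning
    1y+0≡y : ∀ y → + 1 ℤ.* ι y ℤ.+ + 0 ≡ ι y
    1y+0≡y y = trans (ℤ.+-identityʳ _) (ℤ.*-identityˡ (ι y))
    squareful : ∀ q → Prime q → Squareful q 1 (+ 0) P
    squareful q q-prime y Py q∣y with perfect y Py
    ... | m , n , 2≤n , ∣y∣≡mⁿ = ∣ᵤ⇒∣ (subst (q ℕ.* q ℕ.∣_) (sym ∣1y+0∣≡mⁿ)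
                                     (prime∣m^n⇒prime²∣m^n m n q-prime 2≤n (subst (q ℕ.∣_) ∣1y+0∣≡mⁿ (∣⇒∣ᵤ q∣y))))
      where
      ∣1y+0∣≡mⁿ : ℤ.∣ + 1 ℤ.* ι y ℤ.+ + 0 ∣ ≡ m ℕ.^ n
      ∣1y+0∣≡mⁿ = trans (cong ℤ.∣_∣ (1y+0≡y y)) ∣y∣≡mⁿ
    Nμ≤1 : ∀ N → fromℕ N * μ P ≤ 1#
    Nμ≤1 N with ∏[p²-p+1]/∏p²→0 N
    ... | K , NW≤D = fromℕ-*-cancelˡ-≤ (∏p² K) (∏p²≥1 K) (begin
      fromℕ D * (fromℕ N * μ P)     ≡⟨ x*[y*z]≡y*[x*z] (fromℕ D) (fromℕ N) (μ P) ⟩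
      fromℕ N * (fromℕ D * μ P)     ≤⟨ *-monoʳ-≤-nonNeg (fromℕ N) (fromℕ-nonNeg N)
                                         (sieveBound K 1 (+ 0) P (noPrimeFactor≤-1 K) (λ q q-prime _ → squareful q q-prime)) ⟩
      fromℕ N * fromℕ W             ≡⟨ fromℕ-* N W ⟨
      fromℕ (N ℕ.* W)               ≤⟨ fromℕ-mono-≤ NW≤D ⟩
      fromℕ D                       ≡⟨ *-identityʳ (fromℕ D) ⟨
      fromℕ D * 1#                  ∎)
      where
      D : ℕ
      D = ∏p² K
      W : ℕ
      W = ∏[p²-p+1] K

divisionℕ : AffineMaps.DivisionWithRemainder ℕ-Domain
divisionℕ m 1≤m y = y / m , y % m , m%n<n y m ,
  trans (m≡m%n+[m/n]*n y m) (trans (ℕ.+-comm (y % m) ((y / m) ℕ.* m)) (cong (ℕ._+ y % m) (ℕ.*-comm (y / m) m)))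
  where instance _ = ℕ.>-nonZero 1≤m

divisionℤ : AffineMaps.DivisionWithRemainder ℤ-Domain
divisionℤ m 1≤m y = y /ℕ m , y %ℕ m , n%ℕd<d y m ,
  trans (a≡a%ℕn+[a/ℕn]*n y m) (trans (ℤ.+-comm (ℤ.+ (y %ℕ m)) ((y /ℕ m) ℤ.* ℤ.+ m)) (cong (ℤ._+ ℤ.+ (y %ℕ m)) (ℤ.*-comm (y /ℕ m) (ℤ.+ m))))
  where instance _ = ℕ.>-nonZero 1≤m

embeddingℕ : IntegerEmbedding ℕ-Domain
embeddingℕ = record { ι = ℤ.+_ ; ι-scale = ℤ.pos-* ; ι-shift = λ h x → ℤ.pos-+ x h }

embeddingℤ : IntegerEmbedding ℤ-Domain
embeddingℤ = record { ι = λ x → x ; ι-scale = λ _ _ → refl ; ι-shift = λ _ _ → refl }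

corollary3p6 : Domain.Small ℤ-Domain PerfectPowersℤ × Domain.Small ℕ-Domain PerfectPowersℕ
corollary3p6 =
  PerfectPowerSmallness.small ℤ-Domain divisionℤ embeddingℤ PerfectPowersℤ
    (λ { _ (n , 2≤n , a , refl) → ℤ.∣ a ∣ , n , 2≤n , ∣i^n∣≡∣i∣^n a n }) ,
  PerfectPowerSmallness.small ℕ-Domain divisionℕ embeddingℕ PerfectPowersℕ
    (λ { _ (n , 2≤n , a , refl) → a , n , 2≤n , refl })
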